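{- Let $m\ge 4$ and $q=2^m$. If $f$ is an o-polynomial over $\mathrm{GF}(q)$ with $|\hat{\mathcal{B}}_{(f,q/2)}|=q(q-1)^2$, then the incidence structure $\hat{\mathbf{D}}(f,q/2)=(\mathrm{GF}(q),\hat{\mathcal{B}}_{(f,q/2)})$ is a $3$-$\left(q,\ q/2,\ (q-4)(q-1)q/8\right)$ design.
   Context: For a polynomial $f$ over $\mathrm{GF}(q)$ (viewed as a function $\mathrm{GF}(q)\to\mathrm{GF}(q)$) and $(a,b,c)\in\mathrm{GF}(q)^3$, put $\hat{B}_{(f,a,b,c)}=\{af(x)+bx+c: x\in\mathrm{GF}(q)\}$. For an integer $k$ with $2\le k\le q$, $\hat{\mathcal{B}}_{(f,k)}=\{\hat{B}_{(f,a,b,c)}: |\hat{B}_{(f,a,b,c)}|=k,\ (a,b,c)\in\mathrm{GF}(q)^3\}$ (a set, so each block appears once), and $\hat{\mathbf{D}}(f,k)$ is the incidence structure with point set $\mathrm{GF}(q)$, block set $\hat{\mathcal{B}}_{(f,k)}$ and incidence given by membership. A $t$-$(v,k,\lambda)$ design is a pair $(\mathcal{P},\mathcal{B})$ with $|\mathcal{P}|=v$ and $\mathcal{B}$ a set of $k$-subsets of $\mathcal{P}$ such that every $t$-subset of $\mathcal{P}$ is contained in exactly $\lambda$ members of $\mathcal{B}$. With $q=2^m$, an o-polynomial over $\mathrm{GF}(q)$ is a polynomial $f\in\mathrm{GF}(q)[x]$ with $\deg f<q$, $f(0)=0$, $f$ a permutation of $\mathrm{GF}(q)$, and such that for every $a\in\mathrm{GF}(q)$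 the polynomial $(f(x+a)+f(a))x^{q-2}$ is also a permutation of $\mathrm{GF}(q)$ (the normalization $f(1)=1$ is not required). -}

module Defs where

open import Data.Nat using (ℕ; zero; suc; _^_; _∸_)
open import Data.Fin using (Fin) renaming (_≟_ to _≟F_)
open import Data.Fin.Subset using (Subset; ∣_∣; _∈_)
open import Data.Bool using (Bool; true; false) renaming (_≟_ to _≟B_)
open import Data.Vec using (Vec; []; _∷_; tabulate)
open import Data.Vec.Properties using (≡-dec)
open import Data.List using (List; []; _∷_; map; allFin; filter; deduplicate; length; concatMap)
open import Data.Bool.ListAction using (any)
open import Data.Product using (Σ; _×_; _,_)
open import Relation.Nullary using (¬_)
open import Relation.Nullary.Decidable using (⌊_⌋)
open import Relation.Binary.PropositionalEquality using (_≡_)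
open import Function.Definitions using (Bijective)

-- A finite field with q elements, carried (w.l.o.g.) by Fin q, with
-- propositional equality.  GF(q) is unique up to isomorphism, so
-- quantifying over all such structures is the same as talking about GF(q).
record FiniteField (q : ℕ) : Set where
  infixl 6 _+_
  infixl 7 _*_
  field
    _+_ _*_ : Fin q → Fin q → Fin q
    -_      : Fin q → Fin q
    0# 1#   : Fin q
    +-assoc : ∀ x y z → (x + y) + z ≡ x + (y + z)
    +-comm  : ∀ x y → x + y ≡ y + x
    +-idˡ   : ∀ x → 0# + x ≡ x
    -‿invˡ  : ∀ x → (- x) + x ≡ 0#
    *-assoc : ∀ x y z → (x * y) * z ≡ x * (y * z)
    *-comm  : ∀ x y → x * y ≡ y * x
    *-idˡ   : ∀ x → 1# * x ≡ x
    distribˡ : ∀ x y z → x * (y + z) ≡ (x * y) + (x * z)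
    1≢0     : ¬ (1# ≡ 0#)
    inverse : ∀ x → ¬ (x ≡ 0#) → Σ (Fin q) (λ y → y * x ≡ 1#)

module _ {q : ℕ} (F : FiniteField q) where
  open FiniteField F

  pow : Fin q → ℕ → Fin q
  pow x zero    = 1#
  pow x (suc n) = x * pow x n

  -- A polynomial of degree < q: its q coefficients (index i = coeff of x^i).
  Poly : Set
  Poly = Vec (Fin q) q

  evalV : ∀ {n} → Vec (Fin q) n → Fin q → Fin q
  evalV []       x = 0#
  evalV (c ∷ cs) x = c + x * evalV cs x

  eval : Poly → Fin q → Fin q
  eval f = evalV f

  IsPermutation : (Fin q → Fin q) → Set
  IsPermutation g = Bijective _≡_ _≡_ g

  IsOPolynomial : Poly → Set
  IsOPolynomial f =
    (eval f 0# ≡ 0#) ×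
    IsPermutation (eval f) ×
    (∀ a → IsPermutation (λ x → (eval f (x + a) + eval f a) * pow x (q ∸ 2)))

  image : (Fin q → Fin q) → Subset q
  image g = tabulate (λ y → any (λ x → ⌊ g x ≟F y ⌋) (allFin q))

  blockHat : Poly → Fin q → Fin q → Fin q → Subset q
  blockHat f a b c = image (λ x → a * eval f x + b * x + c)

  allTriples : List (Fin q × Fin q × Fin q)
  allTriples = concatMap (λ a → concatMap (λ b → map (λ c → a , b , c) (allFin q)) (allFin q)) (allFin q)

  blocksHat : Poly → ℕ → List (Subset q)
  blocksHat f k =
    deduplicate (≡-dec _≟B_)
      (filter (λ B → ∣ B ∣ Data.Nat.≟ k)
        (map (λ { (a , b , c) → blockHat f a b c }) allTriples))
    where import Data.Nat

module _ {v : ℕ} where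
  open import Data.List.Relation.Unary.Unique.Propositional using (Unique)
  open import Data.List.Relation.Unary.All using (All)

  countContaining3 : List (Subset v) → Fin v → Fin v → Fin v → ℕ
  countContaining3 Bs x y z =
    length (filter (λ B → Data.Fin.Subset.Properties._∈?_ x B Relation.Nullary.×-dec
                         (Data.Fin.Subset.Properties._∈?_ y B Relation.Nullary.×-dec
                          Data.Fin.Subset.Properties._∈?_ z B)) Bs)
    where import Data.Fin.Subset.Properties
          import Relation.Nullary

  Is3Design : List (Subset v) → ℕ → ℕ → Set
  Is3Design Bs k λ' =
    Unique Bs ×
    All (λ B → ∣ B ∣ ≡ k) Bs ×
    (∀ x y z → ¬ (x ≡ y) → ¬ (x ≡ z) → ¬ (y ≡ z) → countContaining3 Bs x y z ≡ λ')

module Submission where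

-- Fix distinct points x, y, z and count the tuples (a, b, c, u₁, u₂, u₃) with
-- a f(uᵢ) + b uᵢ + c = x, y, z respectively, in two ways (TripleCount).  By
-- Cramer's rule each triple of distinct uᵢ is hit by exactly one (a, b, c),
-- giving q (q-1) (q-2).  Per (a, b, c) the count is a product of fibre sizes:
-- u ↦ a f(u) + b u + c is bijective if exactly one of a, b is 0, constant if
-- both are, and two-to-one if a, b ≠ 0 (the o-polynomial property), giving
-- 2 (q-1) q + 8 N with N the number of (a, b, c), a, b ≠ 0, whose block
-- contains x, y, z.  Only these q (q-1)^2 triples give blocks of size q/2,
-- so the hypothesis on the number of blocks makes triples ↦ blocks a
-- bijection (BlockDesign) and N = (q-4) (q-1) q / 8 blocks contain x, y, z.

module FinSums where
  open import Data.Nat using (ℕ; zero; suc; _+_; _*_; _∸_)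
  open import Data.Nat.Properties
    using (+-*-semiring; *-commutativeSemigroup; +-identityʳ; *-distribˡ-+; *-zeroʳ; *-identityˡ; *-identityʳ; m+n∸m≡n; *-distribʳ-∸; ∸-+-assoc)
    renaming (_≟_ to _≟ℕ_)
  open import Data.Fin using (Fin; zero; suc; _≟_)
  open import Data.Fin.Properties using (suc-injective)
  open import Data.Product using (_×_; _,_)
  open import Data.Empty using (⊥-elim)
  open import Data.Bool using (if_then_else_)
  open import Relation.Nullary using (¬_; Dec; does; yes; no; ¬?; _×-dec_)
  open import Relation.Binary.PropositionalEquality
  import Algebra.Properties.Semiring.Sum as SemiringSum
  open import Algebra.Properties.CommutativeSemigroup *-commutativeSemigroup using (x∙yz≈y∙xz)

  private module ℕΣ = SemiringSum +-*-semiring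

  Σ : ∀ {n} → (Fin n → ℕ) → ℕ
  Σ = ℕΣ.sum

  𝟙 : ∀ {p} {P : Set p} → Dec P → ℕ
  𝟙 d = if does d then 1 else 0

  count : ∀ {n p} {P : Fin n → Set p} → (∀ i → Dec (P i)) → ℕ
  count P? = Σ (λ i → 𝟙 (P? i))

  Σ-except : ∀ {n} → Fin n → (Fin n → ℕ) → ℕ
  Σ-except i f = Σ (λ j → 𝟙 (¬? (j ≟ i)) * f j)

  𝟙-yes : ∀ {p} {P : Set p} (d : Dec P) → P → 𝟙 d ≡ 1
  𝟙-yes (yes _) _ = refl
  𝟙-yes (no ¬p) p = ⊥-elim (¬p p)

  𝟙-no : ∀ {p} {P : Set p} (d : Dec P) → ¬ P → 𝟙 d ≡ 0
  𝟙-no (yes p) ¬p = ⊥-elim (¬p p)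
  𝟙-no (no _)  _  = refl

  𝟙≢0⇒ : ∀ {p} {P : Set p} (d : Dec P) → ¬ 𝟙 d ≡ 0 → P
  𝟙≢0⇒ (yes p) _    = p
  𝟙≢0⇒ (no _)  𝟙≢0  = ⊥-elim (𝟙≢0 refl)

  𝟙-× : ∀ {a b} {A : Set a} {B : Set b} (d : Dec A) (e : Dec B) → 𝟙 (d ×-dec e) ≡ 𝟙 d * 𝟙 e
  𝟙-× (yes _) (yes _) = refl
  𝟙-× (yes _) (no _)  = refl
  𝟙-× (no _)  _       = refl

  𝟙-×³ : ∀ {a b c} {A : Set a} {B : Set b} {C : Set c} (d : Dec A) (e : Dec B) (g : Dec C) →
    𝟙 (d ×-dec (e ×-dec g)) ≡ 𝟙 d * (𝟙 e * 𝟙 g)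
  𝟙-×³ d e g = trans (𝟙-× d (e ×-dec g)) (cong (𝟙 d *_) (𝟙-× e g))

  𝟙-*-cong : ∀ {p} {P : Set p} (d : Dec P) {X Y : ℕ} → (P → X ≡ Y) → 𝟙 d * X ≡ 𝟙 d * Y
  𝟙-*-cong (yes p) X≡Y = cong (_+ 0) (X≡Y p)
  𝟙-*-cong (no _)  _   = refl

  Σ-cong : ∀ {n} {f g : Fin n → ℕ} → (∀ i → f i ≡ g i) → Σ f ≡ Σ g
  Σ-cong = ℕΣ.sum-cong-≗

  Σ-+ : ∀ {n} (f g : Fin n → ℕ) → Σ (λ i → f i + g i) ≡ Σ f + Σ g
  Σ-+ = ℕΣ.∑-distrib-+

  Σ-comm : ∀ {m n} (f : Fin m → Fin n → ℕ) → Σ (λ i → Σ (λ j → f i j)) ≡ Σ (λ j → Σ (λ i → f i j))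
  Σ-comm = ℕΣ.∑-comm

  Σ-*ˡ : ∀ {n} (c : ℕ) (f : Fin n → ℕ) → Σ (λ i → c * f i) ≡ c * Σ f
  Σ-*ˡ c f = sym (ℕΣ.*-distribˡ-sum c f)

  Σ-*ʳ : ∀ {n} (c : ℕ) (f : Fin n → ℕ) → Σ (λ i → f i * c) ≡ Σ f * c
  Σ-*ʳ c f = sym (ℕΣ.*-distribʳ-sum c f)

  Σ-const : ∀ {n} (c : ℕ) → Σ {n} (λ _ → c) ≡ n * c
  Σ-const {zero}  c = refl
  Σ-const {suc n} c = cong (c +_) (Σ-const {n} c)

  Σ-zero : ∀ {n} (f : Fin n → ℕ) → (∀ i → f i ≡ 0) → Σ f ≡ 0
  Σ-zero {n} f f≡0 = trans (Σ-cong f≡0) (trans (Σ-const {n} 0) (*-zeroʳ n))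

  Σ-single : ∀ {n} (f : Fin n → ℕ) (i : Fin n) → (∀ j → ¬ j ≡ i → f j ≡ 0) → Σ f ≡ f i
  Σ-single {suc n} f zero    f≡0 =
    trans (cong (f zero +_) (Σ-zero _ (λ j → f≡0 (suc j) (λ ())))) (+-identityʳ _)
  Σ-single {suc n} f (suc i) f≡0 rewrite f≡0 zero (λ ()) =
    Σ-single (λ j → f (suc j)) i (λ j j≢i → f≡0 (suc j) (λ e → j≢i (suc-injective e)))

  Σ-split : ∀ {n} (f : Fin n → ℕ) (i : Fin n) → Σ f ≡ f i + Σ-except i f
  Σ-split f i = begin
      Σ f                                                ≡⟨ Σ-cong split-term ⟩
      Σ (λ j → 𝟙 (j ≟ i) * f j + 𝟙 (¬? (j ≟ i)) * f j)   ≡⟨ Σ-+ (λ j → 𝟙 (j ≟ i) * f j) (λ j → 𝟙 (¬? (j ≟ i)) * f j) ⟩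
      Σ (λ j → 𝟙 (j ≟ i) * f j) + Σ-except i f           ≡⟨ cong (_+ Σ-except i f) at-i ⟩
      f i + Σ-except i f                                 ∎
    where
    open ≡-Reasoning
    split-term : ∀ j → f j ≡ 𝟙 (j ≟ i) * f j + 𝟙 (¬? (j ≟ i)) * f j
    split-term j with j ≟ i
    ... | yes _ = sym (trans (+-identityʳ _) (+-identityʳ _))
    ... | no _  = sym (+-identityʳ _)
    at-i : Σ (λ j → 𝟙 (j ≟ i) * f j) ≡ f i
    at-i = trans (Σ-single _ i (λ j j≢i → cong (_* f j) (𝟙-no (j ≟ i) j≢i)))
                 (trans (cong (_* f i) (𝟙-yes (i ≟ i) refl)) (*-identityˡ (f i)))

  Σ-except-cong : ∀ {n} (i : Fin n) {f g : Fin n → ℕ} → (∀ j → ¬ j ≡ i → f j ≡ g j) →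
    Σ-except i f ≡ Σ-except i g
  Σ-except-cong i f≡g = Σ-cong (λ j → 𝟙-*-cong (¬? (j ≟ i)) (f≡g j))

  Σ-except-+ : ∀ {n} (i : Fin n) (f g : Fin n → ℕ) →
    Σ-except i (λ j → f j + g j) ≡ Σ-except i f + Σ-except i g
  Σ-except-+ i f g = trans (Σ-cong (λ j → *-distribˡ-+ (𝟙 (¬? (j ≟ i))) (f j) (g j)))
                           (Σ-+ (λ j → 𝟙 (¬? (j ≟ i)) * f j) (λ j → 𝟙 (¬? (j ≟ i)) * g j))

  Σ-except-*ˡ : ∀ {n} (i : Fin n) (c : ℕ) (f : Fin n → ℕ) → Σ-except i (λ j → c * f j) ≡ c * Σ-except i f
  Σ-except-*ˡ i c f = trans (Σ-cong (λ j → x∙yz≈y∙xz (𝟙 (¬? (j ≟ i))) c (f j)))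
                            (Σ-*ˡ c (λ j → 𝟙 (¬? (j ≟ i)) * f j))

  Σ-except-const : ∀ {n} (i : Fin n) (c : ℕ) → Σ-except i (λ _ → c) ≡ (n ∸ 1) * c
  Σ-except-const {n} i c = begin
      Σ-except i (λ _ → c)           ≡⟨ sym (m+n∸m≡n c _) ⟩
      c + Σ-except i (λ _ → c) ∸ c   ≡⟨ cong (_∸ c) (sym (Σ-split (λ _ → c) i)) ⟩
      Σ {n} (λ _ → c) ∸ c            ≡⟨ cong (_∸ c) (Σ-const {n} c) ⟩
      n * c ∸ c                      ≡⟨ cong (n * c ∸_) (sym (*-identityˡ c)) ⟩
      n * c ∸ 1 * c                  ≡⟨ sym (*-distribʳ-∸ c n 1) ⟩
      (n ∸ 1) * c                    ∎
    where open ≡-Reasoning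

  count-except₂ : ∀ {n} (i j : Fin n) → ¬ i ≡ j → Σ-except j (λ k → 𝟙 (¬? (k ≟ i))) ≡ n ∸ 2
  count-except₂ {n} i j i≢j = begin
      Σ-except j t             ≡⟨ sym (m+n∸m≡n 1 _) ⟩
      1 + Σ-except j t ∸ 1     ≡⟨ cong (λ s → s + Σ-except j t ∸ 1) (sym (𝟙-yes (¬? (j ≟ i)) (λ e → i≢j (sym e)))) ⟩
      t j + Σ-except j t ∸ 1   ≡⟨ cong (_∸ 1) (sym (Σ-split t j)) ⟩
      Σ t ∸ 1                  ≡⟨ cong (_∸ 1) (trans (Σ-cong (λ k → sym (*-identityʳ (t k)))) (Σ-except-const i 1)) ⟩
      (n ∸ 1) * 1 ∸ 1          ≡⟨ cong (_∸ 1) (*-identityʳ (n ∸ 1)) ⟩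
      n ∸ 1 ∸ 1                ≡⟨ ∸-+-assoc n 1 1 ⟩
      n ∸ 2                    ∎
    where
    open ≡-Reasoning
    t : Fin n → ℕ
    t k = 𝟙 (¬? (k ≟ i))

  count-distinct³ : ∀ {n} →
    Σ {n} (λ i → Σ (λ j → Σ (λ k → 𝟙 (¬? (j ≟ i)) * (𝟙 (¬? (k ≟ j)) * 𝟙 (¬? (k ≟ i))))))
      ≡ n * ((n ∸ 1) * (n ∸ 2))
  count-distinct³ {n} = begin
      Σ {n} (λ i → Σ (λ j → Σ (λ k → 𝟙 (¬? (j ≟ i)) * (𝟙 (¬? (k ≟ j)) * 𝟙 (¬? (k ≟ i))))))
        ≡⟨ Σ-cong {n} (λ i → Σ-cong (λ j → Σ-*ˡ (𝟙 (¬? (j ≟ i))) (λ k → 𝟙 (¬? (k ≟ j)) * 𝟙 (¬? (k ≟ i))))) ⟩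
      Σ {n} (λ i → Σ-except i (λ j → Σ-except j (λ k → 𝟙 (¬? (k ≟ i)))))
        ≡⟨ Σ-cong {n} (λ i → Σ-cong (λ j → 𝟙-*-cong (¬? (j ≟ i)) (λ j≢i → count-except₂ i j (λ e → j≢i (sym e))))) ⟩
      Σ {n} (λ i → Σ-except i (λ _ → n ∸ 2))
        ≡⟨ Σ-cong {n} (λ i → Σ-except-const i (n ∸ 2)) ⟩
      Σ {n} (λ _ → (n ∸ 1) * (n ∸ 2))
        ≡⟨ Σ-const {n} _ ⟩
      n * ((n ∸ 1) * (n ∸ 2)) ∎
    where open ≡-Reasoning

  count-none : ∀ {n p} {P : Fin n → Set p} (P? : ∀ i → Dec (P i)) → (∀ i → ¬ P i) → count P? ≡ 0
  count-none P? none = Σ-zero _ (λ i → 𝟙-no (P? i) (none i))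

  count-unique : ∀ {n p} {P : Fin n → Set p} (P? : ∀ i → Dec (P i)) (i : Fin n) →
    P i → (∀ j → P j → j ≡ i) → count P? ≡ 1
  count-unique P? i Pi only-i =
    trans (Σ-single _ i (λ j j≢i → 𝟙-no (P? j) (λ Pj → j≢i (only-i j Pj)))) (𝟙-yes (P? i) Pi)

  count-two : ∀ {n p} {P : Fin n → Set p} (P? : ∀ i → Dec (P i)) (i j : Fin n) → ¬ i ≡ j →
    P i → P j → (∀ k → P k → ¬ k ≡ i → k ≡ j) → count P? ≡ 2
  count-two P? i j i≢j Pi Pj only-ij = begin
      count P?                               ≡⟨ Σ-split _ i ⟩
      𝟙 (P? i) + Σ-except i (λ k → 𝟙 (P? k)) ≡⟨ cong₂ _+_ (𝟙-yes (P? i) Pi) (trans (Σ-single _ j off-j) at-j) ⟩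
      2                                      ∎
    where
    open ≡-Reasoning
    off-j : ∀ k → ¬ k ≡ j → 𝟙 (¬? (k ≟ i)) * 𝟙 (P? k) ≡ 0
    off-j k k≢j with k ≟ i
    ... | yes _  = refl
    ... | no k≢i = trans (+-identityʳ _) (𝟙-no (P? k) (λ Pk → k≢j (only-ij k Pk k≢i)))
    at-j : 𝟙 (¬? (j ≟ i)) * 𝟙 (P? j) ≡ 1
    at-j rewrite 𝟙-yes (¬? (j ≟ i)) (λ e → i≢j (sym e)) | 𝟙-yes (P? j) Pj = refl

  Σ³-single : ∀ {n} (e : Fin n → Fin n → Fin n → ℕ) (a₀ b₀ c₀ : Fin n) →
    (∀ a b c → ¬ e a b c ≡ 0 → (a ≡ a₀) × (b ≡ b₀) × (c ≡ c₀)) →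
    Σ (λ a → Σ (λ b → Σ (λ c → e a b c))) ≡ e a₀ b₀ c₀
  Σ³-single e a₀ b₀ c₀ support =
    trans (Σ-single _ a₀ (λ a a≢ → Σ-zero _ (λ b → Σ-zero _ (λ c → vanish a b c (λ (p , _) → a≢ p)))))
     (trans (Σ-single _ b₀ (λ b b≢ → Σ-zero _ (λ c → vanish a₀ b c (λ (_ , p , _) → b≢ p))))
       (Σ-single _ c₀ (λ c c≢ → vanish a₀ b₀ c (λ (_ , _ , p) → c≢ p))))
    where
    vanish : ∀ a b c → ¬ ((a ≡ a₀) × (b ≡ b₀) × (c ≡ c₀)) → e a b c ≡ 0
    vanish a b c outside with e a b c ≟ℕ 0
    ... | yes e≡0 = e≡0
    ... | no  e≢0 = ⊥-elim (outside (support a b c e≢0))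

  Σ³-product : ∀ {n} (f g h : Fin n → ℕ) →
    Σ (λ i → Σ (λ j → Σ (λ k → f i * (g j * h k)))) ≡ Σ f * (Σ g * Σ h)
  Σ³-product {n} f g h = begin
      Σ (λ i → Σ (λ j → Σ (λ k → f i * (g j * h k))))  ≡⟨ Σ-cong {n} (λ i → Σ-cong {n} (λ j → inner i j)) ⟩
      Σ (λ i → Σ (λ j → f i * (g j * Σ h)))            ≡⟨ Σ-cong {n} (λ i → trans (Σ-*ˡ (f i) (λ j → g j * Σ h))
                                                                                  (cong (f i *_) (Σ-*ʳ (Σ h) g))) ⟩
      Σ (λ i → f i * (Σ g * Σ h))                      ≡⟨ Σ-*ʳ (Σ g * Σ h) f ⟩
      Σ f * (Σ g * Σ h)                                ∎
    where
    open ≡-Reasoning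
    inner : ∀ i j → Σ (λ k → f i * (g j * h k)) ≡ f i * (g j * Σ h)
    inner i j = trans (Σ-*ˡ (f i) (λ k → g j * h k)) (cong (f i *_) (Σ-*ˡ (g j) h))

  Σ⁴-rotate : ∀ {n m} (g : Fin n → Fin n → Fin n → Fin m → ℕ) →
    Σ (λ a → Σ (λ b → Σ (λ c → Σ (λ u → g a b c u)))) ≡ Σ (λ u → Σ (λ a → Σ (λ b → Σ (λ c → g a b c u))))
  Σ⁴-rotate g =
    trans (Σ-cong (λ a → trans (Σ-cong (λ b → Σ-comm (g a b))) (Σ-comm (λ b u → Σ (λ c → g a b c u)))))
          (Σ-comm (λ a u → Σ (λ b → Σ (λ c → g a b c u))))

module FieldFacts where
  open import Defs
  open import Data.Nat as ℕ using (ℕ; zero; suc; _∸_)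
  open import Data.Fin using (Fin; zero; suc; _≟_)
  open import Data.Fin.Properties using (suc-injective)
  open import Data.Fin.Permutation using (Permutation′; permutation)
  open import Data.Product using (proj₁; proj₂; _,_)
  open import Data.Empty using (⊥-elim)
  open import Relation.Nullary using (¬_; yes; no)
  open import Relation.Binary.PropositionalEquality
  open import Algebra.Bundles using (CommutativeRing)
  open import Algebra.Structures using (IsCommutativeRing)
  import Algebra.Properties.Group as GroupProperties
  import Algebra.Properties.CommutativeMonoid.Sum as MonoidSum
  import Algebra.Definitions.RawMonoid as RawMonoidDefinitions

  Characteristic2 : ∀ {q} → FiniteField q → Set
  Characteristic2 F = let open FiniteField F in 1# + 1# ≡ 0#

  module Properties {q : ℕ} (F : FiniteField q) where
    open FiniteField F public
    open ≡-Reasoning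

    -- F is a commutative ring; this makes the library's ring lemmas and
    -- ring solver available.
    isCommutativeRing : IsCommutativeRing _≡_ _+_ _*_ -_ 0# 1#
    isCommutativeRing = record
      { isRing = record
        { +-isAbelianGroup = record
          { isGroup = record
            { isMonoid = record
              { isSemigroup = record
                { isMagma = record { isEquivalence = isEquivalence ; ∙-cong = cong₂ _+_ }
                ; assoc = +-assoc }
              ; identity = +-idˡ , λ x → trans (+-comm x 0#) (+-idˡ x) }
            ; inverse = -‿invˡ , λ x → trans (+-comm x (- x)) (-‿invˡ x)
            ; ⁻¹-cong = cong -_ }
          ; comm = +-comm }
        ; *-cong = cong₂ _*_
        ; *-assoc = *-assoc
        ; *-identity = *-idˡ , λ x → trans (*-comm x 1#) (*-idˡ x)
        ; distrib = distribˡ , λ x y z → trans (*-comm (y + z) x)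
                                           (trans (distribˡ x y z) (cong₂ _+_ (*-comm x y) (*-comm x z)))
        }
      ; *-comm = *-comm }

    commutativeRing : CommutativeRing _ _
    commutativeRing = record { isCommutativeRing = isCommutativeRing }

    open CommutativeRing commutativeRing public
      using (+-identityʳ; *-identityʳ; distribʳ; zeroˡ; zeroʳ; -‿inverseʳ)
    open GroupProperties (CommutativeRing.+-group commutativeRing) public
      using () renaming (∙-cancelˡ to +-cancelˡ)

    private
      module Additive = MonoidSum (CommutativeRing.+-commutativeMonoid commutativeRing)
      module Multiplicative = MonoidSum (CommutativeRing.*-commutativeMonoid commutativeRing)
    -- n × x = x + ⋯ + x (n summands)
    open RawMonoidDefinitions (CommutativeRing.+-rawMonoid commutativeRing) using (_×_)

    _⁻¹⟨_⟩ : ∀ x → ¬ x ≡ 0# → Fin q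
    x ⁻¹⟨ x≢0 ⟩ = proj₁ (inverse x x≢0)

    ⁻¹-inverseˡ : ∀ x (x≢0 : ¬ x ≡ 0#) → x ⁻¹⟨ x≢0 ⟩ * x ≡ 1#
    ⁻¹-inverseˡ x x≢0 = proj₂ (inverse x x≢0)

    ⁻¹-inverseʳ : ∀ x (x≢0 : ¬ x ≡ 0#) → x * x ⁻¹⟨ x≢0 ⟩ ≡ 1#
    ⁻¹-inverseʳ x x≢0 = trans (*-comm _ _) (⁻¹-inverseˡ x x≢0)

    ⁻¹-nonzero : ∀ x (x≢0 : ¬ x ≡ 0#) → ¬ x ⁻¹⟨ x≢0 ⟩ ≡ 0#
    ⁻¹-nonzero x x≢0 x⁻¹≡0 = 1≢0 (begin
      1#                 ≡⟨ sym (⁻¹-inverseˡ x x≢0) ⟩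
      x ⁻¹⟨ x≢0 ⟩ * x    ≡⟨ cong (_* x) x⁻¹≡0 ⟩
      0# * x             ≡⟨ zeroˡ x ⟩
      0#                 ∎)

    solve-linear : ∀ a (a≢0 : ¬ a ≡ 0#) t w → a * w ≡ t → w ≡ a ⁻¹⟨ a≢0 ⟩ * t
    solve-linear a a≢0 t w aw≡t = begin
      w                        ≡⟨ sym (*-idˡ w) ⟩
      1# * w                   ≡⟨ cong (_* w) (sym (⁻¹-inverseˡ a a≢0)) ⟩
      a ⁻¹⟨ a≢0 ⟩ * a * w      ≡⟨ *-assoc _ _ _ ⟩
      a ⁻¹⟨ a≢0 ⟩ * (a * w)    ≡⟨ cong (a ⁻¹⟨ a≢0 ⟩ *_) aw≡t ⟩
      a ⁻¹⟨ a≢0 ⟩ * t          ∎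

    linear-solution : ∀ a (a≢0 : ¬ a ≡ 0#) t → a * (a ⁻¹⟨ a≢0 ⟩ * t) ≡ t
    linear-solution a a≢0 t =
      trans (sym (*-assoc _ _ _)) (trans (cong (_* t) (⁻¹-inverseʳ a a≢0)) (*-idˡ t))

    *-cancelˡ : ∀ a x y → ¬ a ≡ 0# → a * x ≡ a * y → x ≡ y
    *-cancelˡ a x y a≢0 ax≡ay =
      trans (solve-linear a a≢0 _ x ax≡ay) (sym (solve-linear a a≢0 _ y refl))

    no-zero-divisors : ∀ x y → x * y ≡ 0# → ¬ x ≡ 0# → y ≡ 0#
    no-zero-divisors x y xy≡0 x≢0 = *-cancelˡ x y 0# x≢0 (trans xy≡0 (sym (zeroʳ x)))

    *-nonzero : ∀ x y → ¬ x ≡ 0# → ¬ y ≡ 0# → ¬ x * y ≡ 0#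
    *-nonzero x y x≢0 y≢0 xy≡0 = y≢0 (no-zero-divisors x y xy≡0 x≢0)

    pow≡0⇒≡0 : ∀ x n → pow F x n ≡ 0# → x ≡ 0#
    pow≡0⇒≡0 x zero    1≡0 = ⊥-elim (1≢0 1≡0)
    pow≡0⇒≡0 x (suc n) xⁿ⁺¹≡0 with x ≟ 0#
    ... | yes x≡0 = x≡0
    ... | no  x≢0 = pow≡0⇒≡0 x n (no-zero-divisors x _ xⁿ⁺¹≡0 x≢0)

    -- Additive order: q · x = 0, because translation by x permutes F and
    -- hence leaves the sum of all elements unchanged.
    q×x≡0 : ∀ x → q × x ≡ 0#
    q×x≡0 x = +-cancelˡ S _ _ (begin
        S + q × x                          ≡⟨ cong (S +_) (sym (Additive.sum-replicate q)) ⟩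
        S + Additive.sum {q} (λ _ → x)     ≡⟨ sym (Additive.∑-distrib-+ (λ y → y) (λ _ → x)) ⟩
        Additive.sum (λ y → y + x)         ≡⟨ sym (Additive.∑-permute (λ y → y) translation) ⟩
        S                                  ≡⟨ sym (+-identityʳ S) ⟩
        S + 0#                             ∎)
      where
      S : Fin q
      S = Additive.sum {q} (λ y → y)
      translation : Permutation′ q
      translation = permutation (λ y → y + x) (λ y → y + - x)
        (λ y → trans (+-assoc _ _ _) (trans (cong (y +_) (-‿invˡ x)) (+-identityʳ y)))
        (λ y → trans (+-assoc _ _ _) (trans (cong (y +_) (-‿inverseʳ x)) (+-identityʳ y)))

    ×-+ : ∀ m n x → (m ℕ.+ n) × x ≡ m × x + n × x
    ×-+ zero    n x = sym (+-idˡ _)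
    ×-+ (suc m) n x = trans (cong (x +_) (×-+ m n x)) (sym (+-assoc _ _ _))

    2^m×1≡[1+1]^m : ∀ m → (2 ℕ.^ m) × 1# ≡ pow F (1# + 1#) m
    2^m×1≡[1+1]^m zero    = +-identityʳ 1#
    2^m×1≡[1+1]^m (suc m) = begin
        (2 ℕ.^ m ℕ.+ (2 ℕ.^ m ℕ.+ 0)) × 1#   ≡⟨ ×-+ (2 ℕ.^ m) _ 1# ⟩
        N + (2 ℕ.^ m ℕ.+ 0) × 1#             ≡⟨ cong (N +_) (trans (×-+ (2 ℕ.^ m) 0 1#) (+-identityʳ _)) ⟩
        N + N                                ≡⟨ cong₂ _+_ (2^m×1≡[1+1]^m m) (2^m×1≡[1+1]^m m) ⟩
        P + P                                ≡⟨ sym (cong₂ _+_ (*-idˡ P) (*-idˡ P)) ⟩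
        1# * P + 1# * P                      ≡⟨ sym (distribʳ P 1# 1#) ⟩
        (1# + 1#) * P                        ∎
      where
      N P : Fin q
      N = (2 ℕ.^ m) × 1#
      P = pow F (1# + 1#) m

    characteristic-2 : ∀ m → q ≡ 2 ℕ.^ m → Characteristic2 F
    characteristic-2 m q≡2^m = pow≡0⇒≡0 (1# + 1#) m
      (trans (sym (2^m×1≡[1+1]^m m)) (subst (λ n → n × 1# ≡ 0#) q≡2^m (q×x≡0 1#)))

    ∏ : ∀ {n} → (Fin n → Fin q) → Fin q
    ∏ = Multiplicative.sum

    ∏-nonzero : ∀ {n} (t : Fin n → Fin q) → (∀ i → ¬ t i ≡ 0#) → ¬ ∏ t ≡ 0#
    ∏-nonzero {zero}  t _   = 1≢0
    ∏-nonzero {suc n} t t≢0 = *-nonzero _ _ (t≢0 zero) (∏-nonzero (λ i → t (suc i)) (λ i → t≢0 (suc i)))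

    ∏-const : ∀ {n} x → ∏ {n} (λ _ → x) ≡ pow F x n
    ∏-const {zero}  x = refl
    ∏-const {suc n} x = cong (x *_) (∏-const {n} x)

    ∏-almost-const : ∀ {n} (t : Fin n → Fin q) (i : Fin n) x →
      t i ≡ 1# → (∀ j → ¬ j ≡ i → t j ≡ x) → ∏ t ≡ pow F x (n ∸ 1)
    ∏-almost-const {suc n} t zero x tᵢ≡1 tⱼ≡x =
      trans (cong₂ _*_ tᵢ≡1 (trans (Multiplicative.sum-cong-≗ {n} (λ j → tⱼ≡x (suc j) (λ ()))) (∏-const {n} x)))
            (*-idˡ _)
    ∏-almost-const {suc (suc n)} t (suc i) x tᵢ≡1 tⱼ≡x =
      cong₂ _*_ (tⱼ≡x zero (λ ()))
                (∏-almost-const (λ j → t (suc j)) i x tᵢ≡1 (λ j j≢i → tⱼ≡x (suc j) (λ e → j≢i (suc-injective e))))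

    -- y itself for y ≠ 0, and 1 for y = 0; the product of all unit y is
    -- the product of the non-zero elements.
    unit : Fin q → Fin q
    unit y with y ≟ 0#
    ... | yes _ = 1#
    ... | no  _ = y

    unit-nonzero : ∀ y → ¬ unit y ≡ 0#
    unit-nonzero y with y ≟ 0#
    ... | yes _  = 1≢0
    ... | no y≢0 = y≢0

    -- Fermat's little theorem: multiplication by x ≠ 0 permutes F, so the
    -- product P of the non-zero elements equals x ^ (q - 1) * P.
    fermat : ∀ x → ¬ x ≡ 0# → pow F x (q ∸ 1) ≡ 1#
    fermat x x≢0 = sym (*-cancelˡ P 1# _ (∏-nonzero unit unit-nonzero) (begin
        P * 1#                        ≡⟨ *-identityʳ P ⟩
        P                             ≡⟨ Multiplicative.∑-permute unit scaling ⟩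
        ∏ (λ y → unit (x * y))        ≡⟨ Multiplicative.sum-cong-≗ unit-scaled ⟩
        ∏ (λ y → factor y * unit y)   ≡⟨ Multiplicative.∑-distrib-+ factor unit ⟩
        ∏ factor * P                  ≡⟨ cong (_* P) (∏-almost-const factor 0# x zero-factor other-factors) ⟩
        pow F x (q ∸ 1) * P           ≡⟨ *-comm _ _ ⟩
        P * pow F x (q ∸ 1)           ∎))
      where
      P : Fin q
      P = ∏ unit
      factor : Fin q → Fin q
      factor y with y ≟ 0#
      ... | yes _ = 1#
      ... | no  _ = x
      unit-scaled : ∀ y → unit (x * y) ≡ factor y * unit y
      unit-scaled y with y ≟ 0# | x * y ≟ 0#
      ... | yes _   | yes _    = sym (*-idˡ 1#)
      ... | yes y≡0 | no xy≢0  = ⊥-elim (xy≢0 (trans (cong (x *_) y≡0) (zeroʳ x)))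
      ... | no y≢0  | yes xy≡0 = ⊥-elim (*-nonzero x y x≢0 y≢0 xy≡0)
      ... | no _    | no _     = refl
      zero-factor : factor 0# ≡ 1#
      zero-factor with 0# ≟ 0#
      ... | yes _  = refl
      ... | no 0≢0 = ⊥-elim (0≢0 refl)
      other-factors : ∀ y → ¬ y ≡ 0# → factor y ≡ x
      other-factors y y≢0 with y ≟ 0#
      ... | yes y≡0 = ⊥-elim (y≢0 y≡0)
      ... | no _    = refl
      scaling : Permutation′ q
      scaling = permutation (x *_) (x ⁻¹⟨ x≢0 ⟩ *_)
        (linear-solution x x≢0) (λ y → sym (solve-linear x x≢0 _ y refl))

-- In characteristic 2 every element is its own negative, and polynomial
-- identities can be decided by a ring solver with coefficients in Bool
-- (false ↦ 0, true ↦ 1, xor ↦ +, ∧ ↦ *).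
module CharacteristicTwo where
  open import Defs
  open import Data.Nat using (ℕ)
  open import Data.Fin using (Fin)
  open import Data.Bool using (Bool; true; false; _xor_; _∧_)
  open import Data.Maybe using (Maybe; just; nothing)
  open import Relation.Binary.PropositionalEquality
  open import Algebra.Bundles using (RawRing)
  open import Algebra.Solver.Ring.AlmostCommutativeRing
    using (fromCommutativeRing; _-Raw-AlmostCommutative⟶_)
  import Algebra.Solver.Ring as RingSolver

  module Properties {q : ℕ} (F : FiniteField q) (char-2 : FieldFacts.Characteristic2 F) where
    open FieldFacts.Properties F public
    open ≡-Reasoning

    x+x≡0 : ∀ x → x + x ≡ 0#
    x+x≡0 x = begin
      x + x            ≡⟨ cong₂ _+_ (sym (*-idˡ x)) (sym (*-idˡ x)) ⟩
      1# * x + 1# * x  ≡⟨ sym (distribʳ x 1# 1#) ⟩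
      (1# + 1#) * x    ≡⟨ cong (_* x) char-2 ⟩
      0# * x           ≡⟨ zeroˡ x ⟩
      0#               ∎

    -x≡x : ∀ x → - x ≡ x
    -x≡x x = +-cancelˡ x _ _ (trans (-‿inverseʳ x) (sym (x+x≡0 x)))

    +≡0⇒≡ : ∀ x y → x + y ≡ 0# → x ≡ y
    +≡0⇒≡ x y x+y≡0 = +-cancelˡ y _ _ (trans (+-comm y x) (trans x+y≡0 (sym (x+x≡0 y))))

    ≡⇒+≡0 : ∀ x y → x ≡ y → x + y ≡ 0#
    ≡⇒+≡0 x _ refl = x+x≡0 x

    private
      Coefficients : RawRing _ _
      Coefficients = record
        { Carrier = Bool ; _≈_ = _≡_ ; _+_ = _xor_ ; _*_ = _∧_ ; -_ = λ b → b ; 0# = false ; 1# = true }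

      ⟦_⟧ : Bool → Fin q
      ⟦ false ⟧ = 0#
      ⟦ true  ⟧ = 1#

      morphism : Coefficients -Raw-AlmostCommutative⟶ fromCommutativeRing commutativeRing
      morphism = record
        { ⟦_⟧    = ⟦_⟧
        ; +-homo = λ { false false → sym (+-idˡ 0#)    ; false true → sym (+-idˡ 1#)
                     ; true false  → sym (+-identityʳ 1#) ; true true  → sym char-2 }
        ; *-homo = λ { false false → sym (zeroˡ 0#) ; false true → sym (zeroˡ 1#)
                     ; true false  → sym (zeroʳ 1#) ; true true  → sym (*-idˡ 1#) }
        ; -‿homo = λ b → sym (-x≡x ⟦ b ⟧)
        ; 0-homo = refl
        ; 1-homo = refl }

      ⟦⟧-equal? : ∀ a b → Maybe (⟦ a ⟧ ≡ ⟦ b ⟧)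
      ⟦⟧-equal? false false = just refl
      ⟦⟧-equal? true  true  = just refl
      ⟦⟧-equal? _     _     = nothing

    open RingSolver Coefficients (fromCommutativeRing commutativeRing) morphism ⟦⟧-equal? public
      using (solve; _:=_; _:+_; _:*_; con)

module Images where
  open import Defs
  open FinSums
  open import Data.Nat using (ℕ; suc)
  open import Data.Nat.Properties using (*-identityʳ)
  open import Data.Fin using (Fin; _≟_)
  open import Data.Fin.Subset using (Subset; _∈_; ∣_∣; inside; outside)
  open import Data.Fin.Subset.Properties using (_∈?_)
  open import Data.Vec using ([]; _∷_)
  open import Data.Vec.Properties using ([]=⇒lookup; lookup⇒[]=; lookup∘tabulate)
  open import Data.List using (allFin)
  open import Data.List.Relation.Unary.Any as Any using (satisfied)
  open import Data.List.Relation.Unary.Any.Properties using (any⁺; any⁻)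
  open import Data.List.Membership.Propositional.Properties using (∈-allFin)
  open import Data.Bool using (true)
  open import Data.Bool.ListAction using (any)
  open import Data.Bool.Properties using (T-≡)
  open import Data.Product using (Σ-syntax; _,_)
  open import Relation.Nullary.Decidable using (⌊_⌋; toWitness; fromWitness)
  open import Relation.Binary.PropositionalEquality
  open import Function.Bundles using (Equivalence)

  ∣p∣≡count : ∀ {n} (p : Subset n) → ∣ p ∣ ≡ count (_∈? p)
  ∣p∣≡count []            = refl
  ∣p∣≡count (inside  ∷ p) = cong suc (∣p∣≡count p)
  ∣p∣≡count (outside ∷ p) = ∣p∣≡count p

  module _ {q : ℕ} (F : FiniteField q) where
    ∈-image⁻ : ∀ g v → v ∈ image F g → Σ[ u ∈ Fin q ] g u ≡ v
    ∈-image⁻ g v v∈img =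
      let (u , g[u]≟v) = satisfied (any⁻ _ (allFin q) (Equivalence.from T-≡ found)) in u , toWitness g[u]≟v
      where
      found : any (λ x → ⌊ g x ≟ v ⌋) (allFin q) ≡ true
      found = trans (sym (lookup∘tabulate _ v)) ([]=⇒lookup v∈img)

    ∈-image⁺ : ∀ g u → g u ∈ image F g
    ∈-image⁺ g u = lookup⇒[]= (g u) _ (trans (lookup∘tabulate _ (g u))
        (Equivalence.to T-≡ (any⁺ _ (Any.map (λ { refl → fromWitness refl }) (∈-allFin u)))))

    ∣image∣-surjective : ∀ g → (∀ v → Σ[ u ∈ Fin q ] g u ≡ v) → ∣ image F g ∣ ≡ q
    ∣image∣-surjective g onto = begin
      ∣ image F g ∣                ≡⟨ ∣p∣≡count (image F g) ⟩
      count (_∈? image F g)        ≡⟨ Σ-cong {q} (λ v → 𝟙-yes (v ∈? image F g) (hit v)) ⟩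
      Σ {q} (λ _ → 1)              ≡⟨ trans (Σ-const {q} 1) (*-identityʳ q) ⟩
      q                            ∎
      where
      open ≡-Reasoning
      hit : ∀ v → v ∈ image F g
      hit v = let (u , g[u]≡v) = onto v in subst (_∈ image F g) g[u]≡v (∈-image⁺ g u)

    ∣image∣-constant : ∀ g c → (∀ u → g u ≡ c) → ∣ image F g ∣ ≡ 1
    ∣image∣-constant g c g≡c = trans (∣p∣≡count (image F g))
      (count-unique (_∈? image F g) c (subst (_∈ image F g) (g≡c c) (∈-image⁺ g c))
                    (λ v v∈img → let (u , g[u]≡v) = ∈-image⁻ g v v∈img in trans (sym g[u]≡v) (g≡c u)))

-- For a, b ≠ 0 this map
-- is exactly two-to-one (the defining property of o-polynomials: every
-- non-zero slope through a point of the graph is realised by exactly one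
-- secant), and through any three points with distinct abscissae there is
-- exactly one such map (Cramer's rule; the determinant is non-zero because
-- no three points of the graph are collinear).
module OPolynomialLines where
  open import Defs
  open import Data.Nat as ℕ using (ℕ; suc; _∸_; _≤_; s≤s)
  open import Data.Fin using (Fin; _≟_)
  open import Data.Product using (Σ-syntax; _×_; _,_; proj₁; proj₂)
  open import Data.Fin.Subset using (_∈_)
  open import Data.Fin.Subset.Properties using (_∈?_)
  open import Data.Bool using (false)
  open import Relation.Nullary using (¬_; yes; no)
  open import Relation.Binary.PropositionalEquality
  open FinSums using (𝟙; count; count-none; count-unique; count-two)
  open Images using (∈-image⁺; ∈-image⁻)

  module Properties {q : ℕ} (F : FiniteField q) (char-2 : FieldFacts.Characteristic2 F)
                    (2≤q : 2 ≤ q) (f : Poly F) (o-poly : IsOPolynomial F f) where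
    open CharacteristicTwo.Properties F char-2 public
    open ≡-Reasoning

    φ : Fin q → Fin q
    φ = eval F f

    φ-injective : ∀ {u v} → φ u ≡ φ v → u ≡ v
    φ-injective = proj₁ (proj₁ (proj₂ o-poly))

    φ-surjective : ∀ y → Σ[ u ∈ Fin q ] φ u ≡ y
    φ-surjective y = proj₁ (proj₂ (proj₁ (proj₂ o-poly)) y) , proj₂ (proj₂ (proj₁ (proj₂ o-poly)) y) refl

    line : Fin q → Fin q → Fin q → Fin q → Fin q
    line a b c u = a * φ u + b * u + c

    line-sum : ∀ a b c u v → line a b c u + line a b c v ≡ a * (φ u + φ v) + b * (u + v)
    line-sum a b c u v = solve 7 (λ a b c u v fu fv →
         (a :* fu :+ b :* u :+ c) :+ (a :* fv :+ b :* v :+ c) := a :* (fu :+ fv) :+ b :* (u :+ v))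
       refl a b c u v (φ u) (φ v)

    x*xᵠ⁻²≡1 : ∀ x → ¬ x ≡ 0# → x * pow F x (q ∸ 2) ≡ 1#
    x*xᵠ⁻²≡1 x x≢0 = trans (cong (pow F x) (sym (q∸1≡suc[q∸2] q 2≤q))) (fermat x x≢0)
      where
      q∸1≡suc[q∸2] : ∀ n → 2 ≤ n → n ∸ 1 ≡ suc (n ∸ 2)
      q∸1≡suc[q∸2] (suc (suc n)) (s≤s (s≤s _)) = refl

    Secant : Fin q → Fin q → Fin q → Set
    Secant s u₀ u = φ u + φ u₀ ≡ s * (u + u₀)

    -- The slope map X ↦ (φ(X + u₀) + φ u₀) X^(q-2) of the o-polynomial
    -- condition, which sends X ≠ 0 to the slope of the secant from u₀ to X + u₀.
    slope : Fin q → Fin q → Fin q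
    slope u₀ X = (φ (X + u₀) + φ u₀) * pow F X (q ∸ 2)

    slope-times : ∀ u₀ X → ¬ X ≡ 0# → slope u₀ X * X ≡ φ (X + u₀) + φ u₀
    slope-times u₀ X X≢0 = begin
      D * P * X    ≡⟨ *-assoc D P X ⟩
      D * (P * X)  ≡⟨ cong (D *_) (trans (*-comm P X) (x*xᵠ⁻²≡1 X X≢0)) ⟩
      D * 1#       ≡⟨ *-identityʳ D ⟩
      D            ∎
      where
      D P : Fin q
      D = φ (X + u₀) + φ u₀
      P = pow F X (q ∸ 2)

    slope-zero : ∀ u₀ → slope u₀ 0# ≡ 0#
    slope-zero u₀ = trans (cong (λ t → (φ t + φ u₀) * pow F 0# (q ∸ 2)) (+-idˡ u₀))
                          (trans (cong (_* pow F 0# (q ∸ 2)) (x+x≡0 (φ u₀))) (zeroˡ _))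

    unique-secant : ∀ s → ¬ s ≡ 0# → ∀ u₀ →
      Σ[ p ∈ Fin q ] (¬ p ≡ u₀) × Secant s u₀ p × (∀ u → ¬ u ≡ u₀ → Secant s u₀ u → u ≡ p)
    unique-secant s s≢0 u₀ = X₀ + u₀ , p≢u₀ , secant-p , only-p
      where
      slope-bijective : IsPermutation F (slope u₀)
      slope-bijective = proj₂ (proj₂ o-poly) u₀
      X₀ : Fin q
      X₀ = proj₁ (proj₂ slope-bijective s)
      slope-X₀ : slope u₀ X₀ ≡ s
      slope-X₀ = proj₂ (proj₂ slope-bijective s) refl
      X₀≢0 : ¬ X₀ ≡ 0#
      X₀≢0 X₀≡0 = s≢0 (trans (sym slope-X₀) (trans (cong (slope u₀) X₀≡0) (slope-zero u₀)))
      p≢u₀ : ¬ X₀ + u₀ ≡ u₀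
      p≢u₀ p≡u₀ = X₀≢0 (+-cancelˡ u₀ X₀ 0# (trans (+-comm u₀ X₀) (trans p≡u₀ (sym (+-identityʳ u₀)))))
      secant-p : Secant s u₀ (X₀ + u₀)
      secant-p = begin
        φ (X₀ + u₀) + φ u₀  ≡⟨ sym (slope-times u₀ X₀ X₀≢0) ⟩
        slope u₀ X₀ * X₀    ≡⟨ cong (_* X₀) slope-X₀ ⟩
        s * X₀              ≡⟨ cong (s *_) (solve 2 (λ X u → X := X :+ u :+ u) refl X₀ u₀) ⟩
        s * (X₀ + u₀ + u₀)  ∎
      only-p : ∀ u → ¬ u ≡ u₀ → Secant s u₀ u → u ≡ X₀ + u₀
      only-p u u≢u₀ secant-u = begin
          u                ≡⟨ solve 2 (λ u v → u := u :+ v :+ v) refl u u₀ ⟩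
          X + u₀           ≡⟨ cong (_+ u₀) (proj₁ slope-bijective (trans slope-X (sym slope-X₀))) ⟩
          X₀ + u₀          ∎
        where
        X : Fin q
        X = u + u₀
        X≢0 : ¬ X ≡ 0#
        X≢0 X≡0 = u≢u₀ (+≡0⇒≡ u u₀ X≡0)
        slope-X : slope u₀ X ≡ s
        slope-X = *-cancelˡ X _ _ X≢0 (begin
          X * slope u₀ X            ≡⟨ *-comm X _ ⟩
          slope u₀ X * X            ≡⟨ slope-times u₀ X X≢0 ⟩
          φ (X + u₀) + φ u₀         ≡⟨ cong (λ t → φ t + φ u₀) (solve 2 (λ u v → u :+ v :+ v := u) refl u u₀) ⟩
          φ u + φ u₀                ≡⟨ secant-u ⟩
          s * X                     ≡⟨ *-comm s X ⟩
          X * s                     ∎)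

    module _ (a b c : Fin q) (a≢0 : ¬ a ≡ 0#) where
      private s = a ⁻¹⟨ a≢0 ⟩ * b

      a*s : ∀ X → a * (s * X) ≡ b * X
      a*s X = begin
        a * (a ⁻¹⟨ a≢0 ⟩ * b * X)   ≡⟨ solve 4 (λ a i b X → a :* (i :* b :* X) := (a :* i) :* (b :* X)) refl a (a ⁻¹⟨ a≢0 ⟩) b X ⟩
        a * a ⁻¹⟨ a≢0 ⟩ * (b * X)   ≡⟨ cong (_* (b * X)) (⁻¹-inverseʳ a a≢0) ⟩
        1# * (b * X)                ≡⟨ *-idˡ _ ⟩
        b * X                       ∎

      collision⇒secant : ∀ u v → line a b c u ≡ line a b c v → Secant s v u
      collision⇒secant u v same = *-cancelˡ a _ _ a≢0
        (trans (+≡0⇒≡ _ _ (trans (sym (line-sum a b c u v)) (≡⇒+≡0 _ _ same))) (sym (a*s (u + v))))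

      secant⇒collision : ∀ u v → Secant s v u → line a b c u ≡ line a b c v
      secant⇒collision u v secant =
        +≡0⇒≡ _ _ (trans (line-sum a b c u v) (≡⇒+≡0 _ _ (trans (cong (a *_) secant) (a*s (u + v)))))

      line-two-to-one : ¬ b ≡ 0# → ∀ u₀ →
        Σ[ p ∈ Fin q ] (¬ p ≡ u₀) × line a b c p ≡ line a b c u₀ ×
                       (∀ u → line a b c u ≡ line a b c u₀ → ¬ u ≡ u₀ → u ≡ p)
      line-two-to-one b≢0 u₀ =
        let (p , p≢u₀ , secant-p , only-p) = unique-secant s (*-nonzero _ _ (⁻¹-nonzero a a≢0) b≢0) u₀
        in p , p≢u₀ , secant⇒collision p u₀ secant-p ,
           λ u same u≢u₀ → only-p u u≢u₀ (collision⇒secant u u₀ same)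

    -- No three points of the graph of φ are collinear: the determinant of
    -- the interpolation problem below does not vanish.
    no-three-collinear : ∀ u₁ u₂ u₃ → ¬ u₁ ≡ u₂ → ¬ u₁ ≡ u₃ → ¬ u₂ ≡ u₃ →
      ¬ (φ u₁ + φ u₂) * (u₁ + u₃) + (φ u₁ + φ u₃) * (u₁ + u₂) ≡ 0#
    no-three-collinear u₁ u₂ u₃ u₁≢u₂ u₁≢u₃ u₂≢u₃ Δ≡0 = u₂≢u₃ (trans (only-p u₂ same₂ (λ e → u₁≢u₂ (sym e)))
                                                              (sym (only-p u₃ same₃ (λ e → u₁≢u₃ (sym e)))))
      where
      -- the line through (u₁, φ u₁) and (u₂, φ u₂)
      a b : Fin q
      a = u₁ + u₂
      b = φ u₁ + φ u₂
      a≢0 : ¬ a ≡ 0#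
      a≢0 a≡0 = u₁≢u₂ (+≡0⇒≡ u₁ u₂ a≡0)
      b≢0 : ¬ b ≡ 0#
      b≢0 b≡0 = u₁≢u₂ (φ-injective (+≡0⇒≡ _ _ b≡0))
      only-p : ∀ u → line a b 0# u ≡ line a b 0# u₁ → ¬ u ≡ u₁ → u ≡ proj₁ (line-two-to-one a b 0# a≢0 b≢0 u₁)
      only-p = proj₂ (proj₂ (proj₂ (line-two-to-one a b 0# a≢0 b≢0 u₁)))
      same₂ : line a b 0# u₂ ≡ line a b 0# u₁
      same₂ = +≡0⇒≡ _ _ (trans (line-sum a b 0# u₂ u₁)
        (solve 4 (λ u₁ u₂ f₁ f₂ → (u₁ :+ u₂) :* (f₂ :+ f₁) :+ (f₁ :+ f₂) :* (u₂ :+ u₁) := con false)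
           refl u₁ u₂ (φ u₁) (φ u₂)))
      same₃ : line a b 0# u₃ ≡ line a b 0# u₁
      same₃ = +≡0⇒≡ _ _ (trans (line-sum a b 0# u₃ u₁)
        (trans (solve 6 (λ u₁ u₂ u₃ f₁ f₂ f₃ → (u₁ :+ u₂) :* (f₃ :+ f₁) :+ (f₁ :+ f₂) :* (u₃ :+ u₁)
                                            := (f₁ :+ f₂) :* (u₁ :+ u₃) :+ (f₁ :+ f₃) :* (u₁ :+ u₂))
                  refl u₁ u₂ u₃ (φ u₁) (φ u₂) (φ u₃))
               Δ≡0))

    module Interpolation (u₁ u₂ u₃ : Fin q) (u₁≢u₂ : ¬ u₁ ≡ u₂) (u₁≢u₃ : ¬ u₁ ≡ u₃) (u₂≢u₃ : ¬ u₂ ≡ u₃)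
                         (x₁ x₂ x₃ : Fin q) where
      Passes : Fin q → Fin q → Fin q → Set
      Passes a b c = (line a b c u₁ ≡ x₁) × (line a b c u₂ ≡ x₂) × (line a b c u₃ ≡ x₃)

      private
        F₁₂ F₁₃ U₁₂ U₁₃ X₁₂ X₁₃ Δ A B : Fin q
        F₁₂ = φ u₁ + φ u₂
        F₁₃ = φ u₁ + φ u₃
        U₁₂ = u₁ + u₂
        U₁₃ = u₁ + u₃
        X₁₂ = x₁ + x₂
        X₁₃ = x₁ + x₃
        Δ   = F₁₂ * U₁₃ + F₁₃ * U₁₂
        Δ≢0 : ¬ Δ ≡ 0#
        Δ≢0 = no-three-collinear u₁ u₂ u₃ u₁≢u₂ u₁≢u₃ u₂≢u₃
        A   = X₁₂ * U₁₃ + X₁₃ * U₁₂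
        B   = F₁₂ * X₁₃ + F₁₃ * X₁₂

        -- The 2 × 2 linear system for (a, b) obtained by adding the
        -- interpolation conditions at u₁ and u₂, resp. u₁ and u₃.
        System : Fin q → Fin q → Set
        System a b = (a * F₁₂ + b * U₁₂ ≡ X₁₂) × (a * F₁₃ + b * U₁₃ ≡ X₁₃)

        passes⇒system : ∀ {a b c} → Passes a b c → System a b
        passes⇒system {a} {b} {c} (at₁ , at₂ , at₃) =
          trans (sym (line-sum a b c u₁ u₂)) (cong₂ _+_ at₁ at₂) ,
          trans (sym (line-sum a b c u₁ u₃)) (cong₂ _+_ at₁ at₃)

        anchor : Fin q → Fin q → Fin q
        anchor a b = x₁ + a * φ u₁ + b * u₁

        line-anchor : ∀ a b u → line a b (anchor a b) u ≡ x₁ + (a * (φ u₁ + φ u) + b * (u₁ + u))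
        line-anchor a b u = solve 7 (λ a b x₁ f₁ u₁ f u →
            a :* f :+ b :* u :+ (x₁ :+ a :* f₁ :+ b :* u₁) := x₁ :+ (a :* (f₁ :+ f) :+ b :* (u₁ :+ u)))
          refl a b x₁ (φ u₁) u₁ (φ u) u

        system⇒passes : ∀ {a b} → System a b → Passes a b (anchor a b)
        system⇒passes {a} {b} (eq₁₂ , eq₁₃) =
            solve 5 (λ a b x₁ f₁ u₁ → a :* f₁ :+ b :* u₁ :+ (x₁ :+ a :* f₁ :+ b :* u₁) := x₁) refl a b x₁ (φ u₁) u₁ ,
            trans (line-anchor a b u₂) (trans (cong (x₁ +_) eq₁₂) (cancel x₁ x₂)) ,
            trans (line-anchor a b u₃) (trans (cong (x₁ +_) eq₁₃) (cancel x₁ x₃))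
          where
          cancel : ∀ x y → x + (x + y) ≡ y
          cancel = solve 2 (λ x y → x :+ (x :+ y) := y) refl

        cramer : ∀ {a b} → System a b → (a * Δ ≡ A) × (b * Δ ≡ B)
        cramer {a} {b} (eq₁₂ , eq₁₃) =
          trans (solve 6 (λ a b F₁₂ F₁₃ U₁₂ U₁₃ → a :* (F₁₂ :* U₁₃ :+ F₁₃ :* U₁₂)
                            := (a :* F₁₂ :+ b :* U₁₂) :* U₁₃ :+ (a :* F₁₃ :+ b :* U₁₃) :* U₁₂)
                         refl a b F₁₂ F₁₃ U₁₂ U₁₃)
                (cong₂ (λ s t → s * U₁₃ + t * U₁₂) eq₁₂ eq₁₃) ,
          trans (solve 6 (λ a b F₁₂ F₁₃ U₁₂ U₁₃ → b :* (F₁₂ :* U₁₃ :+ F₁₃ :* U₁₂)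
                            := F₁₂ :* (a :* F₁₃ :+ b :* U₁₃) :+ F₁₃ :* (a :* F₁₂ :+ b :* U₁₂))
                         refl a b F₁₂ F₁₃ U₁₂ U₁₃)
                (cong₂ (λ s t → F₁₂ * s + F₁₃ * t) eq₁₃ eq₁₂)

        divide-by-Δ : ∀ t T → t * Δ ≡ T → t ≡ T * Δ ⁻¹⟨ Δ≢0 ⟩
        divide-by-Δ t T tΔ≡T =
          trans (solve-linear Δ Δ≢0 T t (trans (*-comm Δ t) tΔ≡T)) (*-comm _ T)

      a₀ b₀ c₀ : Fin q
      a₀ = A * Δ ⁻¹⟨ Δ≢0 ⟩
      b₀ = B * Δ ⁻¹⟨ Δ≢0 ⟩
      c₀ = anchor a₀ b₀

      private
        -- The Cramer solution solves the system: both equations follow from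
        -- the polynomial identity  A F + B U = X Δ  (for F, U, X the
        -- differences at u₂, resp. u₃).
        solves-system : System a₀ b₀
        solves-system = equation F₁₂ U₁₂ X₁₂ (identity₁₂ F₁₂ F₁₃ U₁₂ U₁₃ X₁₂ X₁₃) ,
                        equation F₁₃ U₁₃ X₁₃ (identity₁₃ F₁₂ F₁₃ U₁₂ U₁₃ X₁₂ X₁₃)
          where
          identity₁₂ : ∀ F₁₂ F₁₃ U₁₂ U₁₃ X₁₂ X₁₃ →
            (X₁₂ * U₁₃ + X₁₃ * U₁₂) * F₁₂ + (F₁₂ * X₁₃ + F₁₃ * X₁₂) * U₁₂ ≡ X₁₂ * (F₁₂ * U₁₃ + F₁₃ * U₁₂)
          identity₁₂ = solve 6 (λ F₁₂ F₁₃ U₁₂ U₁₃ X₁₂ X₁₃ →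
            (X₁₂ :* U₁₃ :+ X₁₃ :* U₁₂) :* F₁₂ :+ (F₁₂ :* X₁₃ :+ F₁₃ :* X₁₂) :* U₁₂
              := X₁₂ :* (F₁₂ :* U₁₃ :+ F₁₃ :* U₁₂)) refl
          identity₁₃ : ∀ F₁₂ F₁₃ U₁₂ U₁₃ X₁₂ X₁₃ →
            (X₁₂ * U₁₃ + X₁₃ * U₁₂) * F₁₃ + (F₁₂ * X₁₃ + F₁₃ * X₁₂) * U₁₃ ≡ X₁₃ * (F₁₂ * U₁₃ + F₁₃ * U₁₂)
          identity₁₃ = solve 6 (λ F₁₂ F₁₃ U₁₂ U₁₃ X₁₂ X₁₃ →
            (X₁₂ :* U₁₃ :+ X₁₃ :* U₁₂) :* F₁₃ :+ (F₁₂ :* X₁₃ :+ F₁₃ :* X₁₂) :* U₁₃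
              := X₁₃ :* (F₁₂ :* U₁₃ :+ F₁₃ :* U₁₂)) refl
          equation : ∀ F U X → A * F + B * U ≡ X * Δ → a₀ * F + b₀ * U ≡ X
          equation F U X AF+BU≡XΔ = begin
            A * d * F + B * d * U   ≡⟨ solve 5 (λ A B d F U → A :* d :* F :+ B :* d :* U := d :* (A :* F :+ B :* U)) refl A B d F U ⟩
            d * (A * F + B * U)     ≡⟨ cong (d *_) AF+BU≡XΔ ⟩
            d * (X * Δ)             ≡⟨ solve 3 (λ d X Δ → d :* (X :* Δ) := (d :* Δ) :* X) refl d X Δ ⟩
            d * Δ * X               ≡⟨ cong (_* X) (⁻¹-inverseˡ Δ Δ≢0) ⟩
            1# * X                  ≡⟨ *-idˡ X ⟩
            X                       ∎
            where d = Δ ⁻¹⟨ Δ≢0 ⟩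

      interpolant-passes : Passes a₀ b₀ c₀
      interpolant-passes = system⇒passes solves-system

      interpolant-unique : ∀ a b c → Passes a b c → (a ≡ a₀) × (b ≡ b₀) × (c ≡ c₀)
      interpolant-unique a b c passes = a≡a₀ , b≡b₀ , c≡c₀
        where
        aΔ≡A×bΔ≡B : (a * Δ ≡ A) × (b * Δ ≡ B)
        aΔ≡A×bΔ≡B = cramer (passes⇒system passes)
        a≡a₀ : a ≡ a₀
        a≡a₀ = divide-by-Δ a A (proj₁ aΔ≡A×bΔ≡B)
        b≡b₀ : b ≡ b₀
        b≡b₀ = divide-by-Δ b B (proj₂ aΔ≡A×bΔ≡B)
        c≡c₀ : c ≡ c₀
        c≡c₀ = begin
          c                                ≡⟨ solve 5 (λ a b c f u → c := (a :* f :+ b :* u :+ c) :+ a :* f :+ b :* u) refl a b c (φ u₁) u₁ ⟩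
          line a b c u₁ + a * φ u₁ + b * u₁ ≡⟨ cong (λ t → t + a * φ u₁ + b * u₁) (proj₁ passes) ⟩
          anchor a b                       ≡⟨ cong₂ anchor a≡a₀ b≡b₀ ⟩
          c₀                               ∎

    line-0b : ∀ b c u → line 0# b c u ≡ b * u + c
    line-0b b c u = cong (_+ c) (trans (cong (_+ b * u) (zeroˡ (φ u))) (+-idˡ (b * u)))

    line-a0 : ∀ a c u → line a 0# c u ≡ a * φ u + c
    line-a0 a c u = cong (_+ c) (trans (cong (a * φ u +_) (zeroˡ u)) (+-identityʳ (a * φ u)))

    line-00 : ∀ c u → line 0# 0# c u ≡ c
    line-00 c u = trans (line-0b 0# c u) (trans (cong (_+ c) (zeroˡ u)) (+-idˡ c))

    UniquePreimage : (Fin q → Fin q) → Fin q → Set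
    UniquePreimage g v = Σ[ u ∈ Fin q ] (g u ≡ v) × (∀ w → g w ≡ v → w ≡ u)

    scaled-bijective : ∀ k c (g : Fin q → Fin q) → ¬ k ≡ 0# → (∀ {u w} → g u ≡ g w → u ≡ w) →
      (∀ t → Σ[ u ∈ Fin q ] g u ≡ t) → ∀ v → UniquePreimage (λ u → k * g u + c) v
    scaled-bijective k c g k≢0 g-injective g-onto v = u , hits-v , only-u
      where
      t u : Fin q
      t = k ⁻¹⟨ k≢0 ⟩ * (v + c)
      u = proj₁ (g-onto t)
      g[u]≡t : g u ≡ t
      g[u]≡t = proj₂ (g-onto t)
      add-c : ∀ s → s + c ≡ v → s ≡ v + c
      add-c s s+c≡v = trans (solve 2 (λ s c → s := s :+ c :+ c) refl s c) (cong (_+ c) s+c≡v)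
      hits-v : k * g u + c ≡ v
      hits-v = begin
        k * g u + c    ≡⟨ cong (λ s → k * s + c) g[u]≡t ⟩
        k * t + c      ≡⟨ cong (_+ c) (linear-solution k k≢0 (v + c)) ⟩
        v + c + c      ≡⟨ solve 2 (λ v c → v :+ c :+ c := v) refl v c ⟩
        v              ∎
      only-u : ∀ w → k * g w + c ≡ v → w ≡ u
      only-u w hit = g-injective (trans (solve-linear k k≢0 (v + c) (g w) (add-c _ hit)) (sym g[u]≡t))

    UniquePreimage-cong : ∀ {g h : Fin q → Fin q} {v} → (∀ u → g u ≡ h u) → UniquePreimage g v → UniquePreimage h v
    UniquePreimage-cong g≡h (u , hit , only-u) = u , trans (sym (g≡h u)) hit , λ w hw → only-u w (trans (g≡h w) hw)

    -- If exactly one of a, b vanishes, line a b c is bijective: an affine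
    -- map u ↦ b u + c, resp. the permutation φ followed by u ↦ a u + c.
    line-0b-bijective : ∀ b c → ¬ b ≡ 0# → ∀ v → UniquePreimage (line 0# b c) v
    line-0b-bijective b c b≢0 v = UniquePreimage-cong (λ u → sym (line-0b b c u))
      (scaled-bijective b c (λ u → u) b≢0 (λ u≡w → u≡w) (λ t → t , refl) v)

    line-a0-bijective : ∀ a c → ¬ a ≡ 0# → ∀ v → UniquePreimage (line a 0# c) v
    line-a0-bijective a c a≢0 v = UniquePreimage-cong (λ u → sym (line-a0 a c u))
      (scaled-bijective a c φ a≢0 φ-injective φ-surjective v)

    fibre : Fin q → Fin q → Fin q → Fin q → ℕ
    fibre a b c v = count (λ u → line a b c u ≟ v)

    fibre-bijective : ∀ a b c v → UniquePreimage (line a b c) v → fibre a b c v ≡ 1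
    fibre-bijective a b c v (u , hit , only-u) = count-unique (λ u → line a b c u ≟ v) u hit only-u

    fibre-constant : ∀ c v → ¬ v ≡ c → fibre 0# 0# c v ≡ 0
    fibre-constant c v v≢c = count-none (λ u → line 0# 0# c u ≟ v) (λ u hit → v≢c (trans (sym hit) (line-00 c u)))

    fibre-two-to-one : ∀ a b c v → ¬ a ≡ 0# → ¬ b ≡ 0# → fibre a b c v ≡ 2 ℕ.* 𝟙 (v ∈? blockHat F f a b c)
    fibre-two-to-one a b c v a≢0 b≢0 with v ∈? blockHat F f a b c
    ... | no v∉B = count-none (λ u → line a b c u ≟ v) (λ u hit → v∉B (subst (_∈ blockHat F f a b c) hit (∈-image⁺ F (line a b c) u)))
    ... | yes v∈B =
      let (u₀ , hit₀) = ∈-image⁻ F (line a b c) v v∈B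
          (p , p≢u₀ , same , only-p) = line-two-to-one a b c a≢0 b≢0 u₀
      in count-two (λ u → line a b c u ≟ v) u₀ p (λ e → p≢u₀ (sym e)) hit₀ (trans same hit₀)
                   (λ u hit u≢u₀ → only-p u (trans hit (sym hit₀)) u≢u₀)

-- Count the tuples
-- (a, b, c, u₁, u₂, u₃) with a f(uᵢ) + b uᵢ + c equal to x, y, z:
--  * grouped by (u₁, u₂, u₃): the uᵢ must be distinct, and then exactly one
--    (a, b, c) interpolates, giving q (q - 1) (q - 2);
--  * grouped by (a, b, c): the number is the product of the fibre sizes over
--    x, y, z, which is 1 if exactly one of a, b vanishes, 0 if both do, and
--    2 ^ 3 · [x, y, z ∈ B̂(f,a,b,c)] if a, b ≠ 0 (the map is two-to-one).
-- Hence q (q - 1) (q - 2) = 2 (q - 1) q + 8 N, where N is the number of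
-- triples (a, b, c) with a, b ≠ 0 whose block contains x, y and z.
module TripleCount where
  open import Defs
  open FinSums
  open Images
  open import Data.Nat using (ℕ; _+_; _*_; _∸_; _≤_)
  open import Data.Nat.Properties using (*-zeroʳ; *-identityʳ)
  open import Data.Fin using (Fin; _≟_)
  open import Data.Fin.Subset using (Subset; _∈_)
  open import Data.Fin.Subset.Properties using (_∈?_)
  open import Data.Product using (_×_; _,_)
  open import Relation.Nullary using (¬_; Dec; yes; no; ¬?; _×-dec_)
  open import Relation.Binary.PropositionalEquality
  open import Data.Nat.Tactic.RingSolver using (solve-∀)

  Contains? : ∀ {n} (x y z : Fin n) (B : Subset n) → Dec (x ∈ B × y ∈ B × z ∈ B)
  Contains? x y z B = (x ∈? B) ×-dec ((y ∈? B) ×-dec (z ∈? B))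

  module _ {q : ℕ} (F : FiniteField q) (char-2 : FieldFacts.Characteristic2 F)
           (2≤q : 2 ≤ q) (f : Poly F) (o-poly : IsOPolynomial F f)
           (x y z : Fin q) (x≢y : ¬ x ≡ y) (x≢z : ¬ x ≡ z) (y≢z : ¬ y ≡ z) where
    open OPolynomialLines.Properties F char-2 2≤q f o-poly
      using (0#; line; module Interpolation; fibre; fibre-bijective; fibre-constant; fibre-two-to-one;
             line-0b-bijective; line-a0-bijective)
    open ≡-Reasoning

    N : ℕ
    N = Σ-except 0# (λ a → Σ-except 0# (λ b → Σ (λ c → 𝟙 (Contains? x y z (blockHat F f a b c)))))

    hits? : ∀ a b c u₁ u₂ u₃ → Dec ((line a b c u₁ ≡ x) × (line a b c u₂ ≡ y) × (line a b c u₃ ≡ z))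
    hits? a b c u₁ u₂ u₃ = (line a b c u₁ ≟ x) ×-dec ((line a b c u₂ ≟ y) ×-dec (line a b c u₃ ≟ z))

    Σ³ : (Fin q → Fin q → Fin q → ℕ) → ℕ
    Σ³ g = Σ (λ a → Σ (λ b → Σ (λ c → g a b c)))

    no-hits : ∀ {u₁ u₂ u₃} → (∀ a b c → ¬ ((line a b c u₁ ≡ x) × (line a b c u₂ ≡ y) × (line a b c u₃ ≡ z))) →
      Σ³ (λ a b c → 𝟙 (hits? a b c u₁ u₂ u₃)) ≡ 0
    no-hits {u₁} {u₂} {u₃} none =
      Σ-zero _ (λ a → Σ-zero _ (λ b → Σ-zero _ (λ c → 𝟙-no (hits? a b c u₁ u₂ u₃) (none a b c))))

    hits-for-points : ∀ u₁ u₂ u₃ →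
      Σ³ (λ a b c → 𝟙 (hits? a b c u₁ u₂ u₃)) ≡ 𝟙 (¬? (u₂ ≟ u₁)) * (𝟙 (¬? (u₃ ≟ u₂)) * 𝟙 (¬? (u₃ ≟ u₁)))
    hits-for-points u₁ u₂ u₃ with u₂ ≟ u₁ | u₃ ≟ u₂ | u₃ ≟ u₁
    ... | yes u₂≡u₁ | _ | _ = no-hits (λ { a b c (at₁ , at₂ , _) →
            x≢y (trans (sym at₁) (trans (cong (line a b c) (sym u₂≡u₁)) at₂)) })
    ... | no _ | yes u₃≡u₂ | _ = no-hits (λ { a b c (_ , at₂ , at₃) →
            y≢z (trans (sym at₂) (trans (cong (line a b c) (sym u₃≡u₂)) at₃)) })
    ... | no _ | no _ | yes u₃≡u₁ = no-hits (λ { a b c (at₁ , _ , at₃) →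
            x≢z (trans (sym at₁) (trans (cong (line a b c) (sym u₃≡u₁)) at₃)) })
    ... | no u₂≢u₁ | no u₃≢u₂ | no u₃≢u₁ =
        trans (Σ³-single _ a₀ b₀ c₀ (λ a b c hit → interpolant-unique a b c (𝟙≢0⇒ (hits? a b c u₁ u₂ u₃) hit)))
              (𝟙-yes (hits? a₀ b₀ c₀ u₁ u₂ u₃) interpolant-passes)
      where
      open Interpolation u₁ u₂ u₃ (λ e → u₂≢u₁ (sym e)) (λ e → u₃≢u₁ (sym e)) (λ e → u₃≢u₂ (sym e)) x y z

    total-by-points : Σ³ (λ a b c → Σ³ (λ u₁ u₂ u₃ → 𝟙 (hits? a b c u₁ u₂ u₃))) ≡ q * ((q ∸ 1) * (q ∸ 2))
    total-by-points = begin
      Σ³ (λ a b c → Σ³ (λ u₁ u₂ u₃ → H a b c u₁ u₂ u₃))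
        ≡⟨ Σ⁴-rotate (λ a b c u₁ → Σ (λ u₂ → Σ (λ u₃ → H a b c u₁ u₂ u₃))) ⟩
      Σ (λ u₁ → Σ³ (λ a b c → Σ (λ u₂ → Σ (λ u₃ → H a b c u₁ u₂ u₃))))
        ≡⟨ Σ-cong {q} (λ u₁ → Σ⁴-rotate (λ a b c u₂ → Σ (λ u₃ → H a b c u₁ u₂ u₃))) ⟩
      Σ (λ u₁ → Σ (λ u₂ → Σ³ (λ a b c → Σ (λ u₃ → H a b c u₁ u₂ u₃))))
        ≡⟨ Σ-cong {q} (λ u₁ → Σ-cong {q} (λ u₂ → Σ⁴-rotate (λ a b c u₃ → H a b c u₁ u₂ u₃))) ⟩
      Σ³ (λ u₁ u₂ u₃ → Σ³ (λ a b c → H a b c u₁ u₂ u₃))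
        ≡⟨ Σ-cong {q} (λ u₁ → Σ-cong {q} (λ u₂ → Σ-cong {q} (λ u₃ → hits-for-points u₁ u₂ u₃))) ⟩
      Σ³ (λ u₁ u₂ u₃ → 𝟙 (¬? (u₂ ≟ u₁)) * (𝟙 (¬? (u₃ ≟ u₂)) * 𝟙 (¬? (u₃ ≟ u₁))))
        ≡⟨ count-distinct³ {q} ⟩
      q * ((q ∸ 1) * (q ∸ 2)) ∎
      where
      H : Fin q → Fin q → Fin q → Fin q → Fin q → Fin q → ℕ
      H a b c u₁ u₂ u₃ = 𝟙 (hits? a b c u₁ u₂ u₃)

    incidences : Fin q → Fin q → Fin q → ℕ
    incidences a b c = fibre a b c x * (fibre a b c y * fibre a b c z)

    hits-for-line : ∀ a b c → Σ³ (λ u₁ u₂ u₃ → 𝟙 (hits? a b c u₁ u₂ u₃)) ≡ incidences a b c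
    hits-for-line a b c =
      trans (Σ-cong {q} (λ u₁ → Σ-cong {q} (λ u₂ → Σ-cong {q} (λ u₃ →
               𝟙-×³ (line a b c u₁ ≟ x) (line a b c u₂ ≟ y) (line a b c u₃ ≟ z)))))
            (Σ³-product (λ u → 𝟙 (line a b c u ≟ x)) (λ u → 𝟙 (line a b c u ≟ y)) (λ u → 𝟙 (line a b c u ≟ z)))

    incidences-00 : ∀ c → incidences 0# 0# c ≡ 0
    incidences-00 c with x ≟ c
    ... | yes x≡c = trans (cong (λ t → fibre 0# 0# c x * (t * fibre 0# 0# c z))
                                (fibre-constant c y (λ y≡c → x≢y (trans x≡c (sym y≡c)))))
                          (*-zeroʳ (fibre 0# 0# c x))
    ... | no x≢c  = cong (_* (fibre 0# 0# c y * fibre 0# 0# c z)) (fibre-constant c x x≢c)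

    incidences-0b : ∀ b c → ¬ b ≡ 0# → incidences 0# b c ≡ 1
    incidences-0b b c b≢0 = cong₂ (λ s t → s * t) (one x) (cong₂ _*_ (one y) (one z))
      where
      one : ∀ v → fibre 0# b c v ≡ 1
      one v = fibre-bijective 0# b c v (line-0b-bijective b c b≢0 v)

    incidences-a0 : ∀ a c → ¬ a ≡ 0# → incidences a 0# c ≡ 1
    incidences-a0 a c a≢0 = cong₂ (λ s t → s * t) (one x) (cong₂ _*_ (one y) (one z))
      where
      one : ∀ v → fibre a 0# c v ≡ 1
      one v = fibre-bijective a 0# c v (line-a0-bijective a c a≢0 v)

    incidences-ab : ∀ a b c → ¬ a ≡ 0# → ¬ b ≡ 0# → incidences a b c ≡ 8 * 𝟙 (Contains? x y z (blockHat F f a b c))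
    incidences-ab a b c a≢0 b≢0 = begin
      incidences a b c                         ≡⟨ cong₂ _*_ (two x) (cong₂ _*_ (two y) (two z)) ⟩
      2 * 𝟙 x∈B * (2 * 𝟙 y∈B * (2 * 𝟙 z∈B))   ≡⟨ solve-∀-8 (𝟙 x∈B) (𝟙 y∈B) (𝟙 z∈B) ⟩
      8 * (𝟙 x∈B * (𝟙 y∈B * 𝟙 z∈B))           ≡⟨ cong (8 *_) (sym (𝟙-×³ x∈B y∈B z∈B)) ⟩
      8 * 𝟙 (Contains? x y z B)                ∎
      where
      B : Subset q
      B = blockHat F f a b c
      x∈B : Dec (x ∈ B)
      y∈B : Dec (y ∈ B)
      z∈B : Dec (z ∈ B)
      x∈B = x ∈? B
      y∈B = y ∈? B
      z∈B = z ∈? B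
      two : ∀ v → fibre a b c v ≡ 2 * 𝟙 (v ∈? B)
      two v = fibre-two-to-one a b c v a≢0 b≢0
      solve-∀-8 : ∀ i j k → 2 * i * (2 * j * (2 * k)) ≡ 8 * (i * (j * k))
      solve-∀-8 = solve-∀

    total-by-lines : Σ³ incidences ≡ (q ∸ 1) * q + ((q ∸ 1) * q + 8 * N)
    total-by-lines = begin
      Σ³ incidences                             ≡⟨ Σ-split {q} R 0# ⟩
      R 0# + Σ-except 0# R                      ≡⟨ cong₂ _+_ R-zero (Σ-except-cong 0# R-nonzero) ⟩
      (q ∸ 1) * q + Σ-except 0# (λ a → q + 8 * W a)
        ≡⟨ cong ((q ∸ 1) * q +_) (trans (Σ-except-+ 0# (λ _ → q) (λ a → 8 * W a))
                                        (cong₂ _+_ (Σ-except-const 0# q) (Σ-except-*ˡ 0# 8 W))) ⟩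
      (q ∸ 1) * q + ((q ∸ 1) * q + 8 * N)      ∎
      where
      R : Fin q → ℕ
      R a = Σ (λ b → Σ (λ c → incidences a b c))
      W : Fin q → ℕ
      W a = Σ-except 0# (λ b → Σ (λ c → 𝟙 (Contains? x y z (blockHat F f a b c))))
      all-ones : ∀ (g : Fin q → ℕ) → (∀ c → g c ≡ 1) → Σ g ≡ q
      all-ones g g≡1 = trans (Σ-cong {q} g≡1) (trans (Σ-const {q} 1) (*-identityʳ q))
      R-zero : R 0# ≡ (q ∸ 1) * q
      R-zero = begin
        R 0#                                          ≡⟨ Σ-split {q} (λ b → Σ (λ c → incidences 0# b c)) 0# ⟩
        Σ (incidences 0# 0#) + Σ-except 0# (λ b → Σ (incidences 0# b))
          ≡⟨ cong₂ _+_ (Σ-zero _ incidences-00)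
                       (Σ-except-cong 0# (λ b b≢0 → all-ones _ (λ c → incidences-0b b c b≢0))) ⟩
        Σ-except 0# (λ _ → q)                         ≡⟨ Σ-except-const 0# q ⟩
        (q ∸ 1) * q                                   ∎
      R-nonzero : ∀ a → ¬ a ≡ 0# → R a ≡ q + 8 * W a
      R-nonzero a a≢0 = begin
        R a                                           ≡⟨ Σ-split {q} (λ b → Σ (λ c → incidences a b c)) 0# ⟩
        Σ (incidences a 0#) + Σ-except 0# (λ b → Σ (incidences a b))
          ≡⟨ cong₂ _+_ (all-ones _ (λ c → incidences-a0 a c a≢0))
                       (Σ-except-cong 0# (λ b b≢0 → trans (Σ-cong {q} (λ c → incidences-ab a b c a≢0 b≢0))
                                                          (Σ-*ˡ 8 (λ c → 𝟙 (Contains? x y z (blockHat F f a b c)))))) ⟩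
        q + Σ-except 0# (λ b → 8 * Σ (λ c → 𝟙 (Contains? x y z (blockHat F f a b c))))
          ≡⟨ cong (q +_) (Σ-except-*ˡ 0# 8 _) ⟩
        q + 8 * W a                                   ∎

    triple-count : q * ((q ∸ 1) * (q ∸ 2)) ≡ (q ∸ 1) * q + ((q ∸ 1) * q + 8 * N)
    triple-count = begin
      q * ((q ∸ 1) * (q ∸ 2))                                      ≡⟨ sym total-by-points ⟩
      Σ³ (λ a b c → Σ³ (λ u₁ u₂ u₃ → 𝟙 (hits? a b c u₁ u₂ u₃)))   ≡⟨ Σ-cong {q} (λ a → Σ-cong {q} (λ b → Σ-cong {q} (hits-for-line a b))) ⟩
      Σ³ incidences                                                ≡⟨ total-by-lines ⟩
      (q ∸ 1) * q + ((q ∸ 1) * q + 8 * N)                          ∎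

module ListCounting where
  open FinSums using (Σ; 𝟙)
  open import Data.Nat using (ℕ; zero; suc; _+_; _*_; _≤_; z≤n; s≤s)
  open import Data.Nat.Properties
    using (≤-trans; ≤-reflexive; ≤-antisym; +-suc; +-assoc; +-identityʳ; +-monoʳ-≤; +-cancelʳ-≤)
  open import Data.Fin using (Fin; zero; suc)
  open import Data.List using (List; []; _∷_; map; filter; length; concatMap; _++_; allFin; tabulate)
  open import Data.List.Properties using (length-++; length-map; map-tabulate)
  open import Data.Nat.ListAction using (sum)
  open import Data.List.Relation.Unary.Any using (here; there)
  open import Data.List.Relation.Unary.All as All using ()
  open import Data.List.Relation.Unary.AllPairs using (_∷_)
  open import Data.List.Relation.Unary.Unique.Propositional using (Unique)
  import Data.List.Relation.Unary.Unique.Propositional.Properties as Unique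
  open import Data.List.Membership.Propositional using (_∈_)
  open import Data.List.Membership.Propositional.Properties
    using (∈-∃++; ∈-++⁻; ∈-++⁺ˡ; ∈-++⁺ʳ; ∈-map⁺; ∈-filter⁺; ∈-filter⁻)
  open import Data.Product using (Σ-syntax; _×_; _,_)
  open import Data.Sum using (inj₁; inj₂)
  open import Data.Empty using (⊥-elim)
  open import Relation.Nullary using (yes; no; ¬?)
  open import Relation.Unary using (Pred; Decidable)
  open import Relation.Binary.PropositionalEquality

  Lsum : ∀ {a} {A : Set a} → List A → (A → ℕ) → ℕ
  Lsum xs t = sum (map t xs)

  Lsum-++ : ∀ {a} {A : Set a} (xs ys : List A) t → Lsum (xs ++ ys) t ≡ Lsum xs t + Lsum ys t
  Lsum-++ []       ys t = refl
  Lsum-++ (x ∷ xs) ys t = trans (cong (t x +_) (Lsum-++ xs ys t)) (sym (+-assoc (t x) _ _))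

  Lsum-map : ∀ {a b} {A : Set a} {B : Set b} (g : A → B) (xs : List A) t → Lsum (map g xs) t ≡ Lsum xs (λ x → t (g x))
  Lsum-map g []       t = refl
  Lsum-map g (x ∷ xs) t = cong (t (g x) +_) (Lsum-map g xs t)

  Lsum-concatMap : ∀ {a b} {A : Set a} {B : Set b} (k : A → List B) (xs : List A) t →
    Lsum (concatMap k xs) t ≡ Lsum xs (λ x → Lsum (k x) t)
  Lsum-concatMap k []       t = refl
  Lsum-concatMap k (x ∷ xs) t =
    trans (Lsum-++ (k x) (concatMap k xs) t) (cong (Lsum (k x) t +_) (Lsum-concatMap k xs t))

  Lsum-allFin : ∀ {n} (t : Fin n → ℕ) → Lsum (allFin n) t ≡ Σ t
  Lsum-allFin t = trans (cong sum (map-tabulate (λ i → i) t)) (sum-tabulate t)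
    where
    sum-tabulate : ∀ {n} (t : Fin n → ℕ) → sum (tabulate t) ≡ Σ t
    sum-tabulate {zero}  t = refl
    sum-tabulate {suc n} t = cong (t zero +_) (sum-tabulate (λ i → t (suc i)))

  Lsum-filter : ∀ {a p} {A : Set a} {P : Pred A p} (P? : Decidable P) xs t →
    Lsum (filter P? xs) t ≡ Lsum xs (λ x → 𝟙 (P? x) * t x)
  Lsum-filter P? []       t = refl
  Lsum-filter P? (x ∷ xs) t with P? x
  ... | yes _ = cong₂ _+_ (sym (+-identityʳ (t x))) (Lsum-filter P? xs t)
  ... | no _  = Lsum-filter P? xs t

  length≡Lsum : ∀ {a} {A : Set a} (xs : List A) → length xs ≡ Lsum xs (λ _ → 1)
  length≡Lsum []       = refl
  length≡Lsum (x ∷ xs) = cong suc (length≡Lsum xs)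

  length-filter : ∀ {a p} {A : Set a} {P : Pred A p} (P? : Decidable P) xs →
    length (filter P? xs) ≡ Lsum xs (λ x → 𝟙 (P? x))
  length-filter P? []       = refl
  length-filter P? (x ∷ xs) with P? x
  ... | yes _ = cong suc (length-filter P? xs)
  ... | no _  = length-filter P? xs

  length-partition : ∀ {a p} {A : Set a} {P : Pred A p} (P? : Decidable P) xs →
    length (filter P? xs) + length (filter (λ x → ¬? (P? x)) xs) ≡ length xs
  length-partition P? []       = refl
  length-partition P? (x ∷ xs) with P? x
  ... | yes _ = cong suc (length-partition P? xs)
  ... | no _  = trans (+-suc _ _) (cong suc (length-partition P? xs))

  unique-⊆⇒length≤ : ∀ {a} {A : Set a} (xs ys : List A) → Unique xs → (∀ {e} → e ∈ xs → e ∈ ys) →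
    length xs ≤ length ys
  unique-⊆⇒length≤ []       ys _              _   = z≤n
  unique-⊆⇒length≤ (x ∷ xs) ys (x∉xs ∷ uniq) xs⊆ys with ∈-∃++ (xs⊆ys (here refl))
  ... | ys₁ , ys₂ , refl = ≤-trans (s≤s (unique-⊆⇒length≤ xs (ys₁ ++ ys₂) uniq xs⊆ys₁++ys₂))
                                   (≤-reflexive (sym length-without-x))
    where
    length-without-x : length (ys₁ ++ x ∷ ys₂) ≡ suc (length (ys₁ ++ ys₂))
    length-without-x = trans (length-++ ys₁) (trans (+-suc _ _) (cong suc (sym (length-++ ys₁))))
    xs⊆ys₁++ys₂ : ∀ {e} → e ∈ xs → e ∈ ys₁ ++ ys₂
    xs⊆ys₁++ys₂ e∈xs with ∈-++⁻ ys₁ (xs⊆ys (there e∈xs))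
    ... | inj₁ e∈ys₁         = ∈-++⁺ˡ e∈ys₁
    ... | inj₂ (here refl)   = ⊥-elim (All.lookup x∉xs e∈xs refl)
    ... | inj₂ (there e∈ys₂) = ∈-++⁺ʳ ys₁ e∈ys₂

  squeeze : ∀ a b A B → a ≤ A → b ≤ B → a + b ≡ A + B → a ≡ A
  squeeze a b A B a≤A b≤B a+b≡A+B =
    ≤-antisym a≤A (+-cancelʳ-≤ B A a (≤-trans (≤-reflexive (sym a+b≡A+B)) (+-monoʳ-≤ a b≤B)))

  -- If every entry of a duplicate-free list D is the image under g of an
  -- entry of G, and D and G have the same length, then g induces a
  -- bijection, so every decidable property is shared by equally many
  -- entries of D and of G.
  covering-preserves-counts : ∀ {a b p} {A : Set a} {B : Set b} (g : A → B) (G : List A) (D : List B) →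
    Unique D → (∀ {d} → d ∈ D → Σ[ t ∈ A ] t ∈ G × d ≡ g t) → length D ≡ length G →
    ∀ {P : Pred B p} (P? : Decidable P) → length (filter P? D) ≡ length (filter (λ t → P? (g t)) G)
  covering-preserves-counts {A = A} {B = B} g G D uniq covered |D|≡|G| P? =
    squeeze (length (filter P? D)) (length (filter (λ d → ¬? (P? d)) D))
            (length (filter (λ t → P? (g t)) G)) (length (filter (λ t → ¬? (P? (g t))) G))
            (bound P?) (bound (λ d → ¬? (P? d)))
            (trans (length-partition P? D) (trans |D|≡|G| (sym (length-partition (λ t → P? (g t)) G))))
    where
    bound : ∀ {ℓ} {Q : Pred B ℓ} (Q? : Decidable Q) → length (filter Q? D) ≤ length (filter (λ t → Q? (g t)) G)
    bound Q? = ≤-trans (unique-⊆⇒length≤ (filter Q? D) (map g G′) (Unique.filter⁺ Q? uniq) covered-by-image)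
                       (≤-reflexive (length-map g G′))
      where
      G′ : List A
      G′ = filter (λ t → Q? (g t)) G
      covered-by-image : ∀ {d} → d ∈ filter Q? D → d ∈ map g G′
      covered-by-image d∈ with ∈-filter⁻ Q? {xs = D} d∈
      ... | d∈D , Qd with covered d∈D
      ... | t , t∈G , refl = ∈-map⁺ g (∈-filter⁺ (λ t → Q? (g t)) t∈G Qd)

module Arithmetic where
  open import Data.Nat using (ℕ; suc; _+_; _*_; _∸_; _^_; _/_; _≤_; z≤n; s≤s)
  open import Data.Nat.Properties
    using (*-comm; +-cancelˡ-≡; +-identityʳ; ^-monoʳ-≤; m^n>0; <⇒≢)
  open import Data.Nat.DivMod using (m*n/n≡m)
  open import Data.Nat.Tactic.RingSolver using (solve-∀)
  open import Relation.Nullary using (¬_)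
  open import Relation.Binary.PropositionalEquality

  solve-for-N : ∀ q N → 4 ≤ q → q * ((q ∸ 1) * (q ∸ 2)) ≡ (q ∸ 1) * q + ((q ∸ 1) * q + 8 * N) →
    (q ∸ 4) * (q ∸ 1) * q / 8 ≡ N
  solve-for-N (suc (suc (suc (suc r)))) N (s≤s (s≤s (s≤s (s≤s _)))) counted =
    trans (cong (_/ 8) (trans 8N≡ (*-comm 8 N))) (m*n/n≡m N 8)
    where
    expand : ∀ r → (4 + r) * ((3 + r) * (2 + r)) ≡ (3 + r) * (4 + r) + ((3 + r) * (4 + r) + r * (3 + r) * (4 + r))
    expand = solve-∀
    8N≡ : r * (3 + r) * (4 + r) ≡ 8 * N
    8N≡ = +-cancelˡ-≡ ((3 + r) * (4 + r)) _ _ (+-cancelˡ-≡ ((3 + r) * (4 + r)) _ _ (trans (sym (expand r)) counted))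

  half-of-power : ∀ n → 2 ^ suc n / 2 ≡ 2 ^ n
  half-of-power n = trans (cong (_/ 2) (*-comm 2 (2 ^ n))) (m*n/n≡m (2 ^ n) 2)

  4≤2^m : ∀ m → 2 ≤ m → 4 ≤ 2 ^ m
  4≤2^m m 2≤m = ^-monoʳ-≤ 2 2≤m

  half≢1 : ∀ m → 2 ≤ m → ¬ 2 ^ m / 2 ≡ 1
  half≢1 (suc (suc n)) (s≤s (s≤s _)) half≡1 = <⇒≢ (^-monoʳ-≤ 2 (s≤s (z≤n {n}))) (sym (trans (sym (half-of-power (suc n))) half≡1))

  half≢whole : ∀ m → 2 ≤ m → ¬ 2 ^ m / 2 ≡ 2 ^ m
  half≢whole (suc n) _ half≡whole = <⇒≢ (m^n>0 2 n) (sym 2ⁿ≡0)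
    where
    x : ℕ
    x = 2 ^ n
    2ⁿ≡0 : x ≡ 0
    2ⁿ≡0 = trans (sym (+-identityʳ x))
                 (sym (+-cancelˡ-≡ x 0 (x + 0) (trans (+-identityʳ x) (trans (sym (half-of-power n)) half≡whole))))

-- The blocks of size q / 2.  Only the lines with a, b ≠ 0 ("non-degenerate"
-- triples) produce blocks of this size; under the hypothesis that there
-- are exactly as many blocks as non-degenerate triples, the number of
-- blocks through x, y, z equals the number N of non-degenerate triples
-- whose block contains them.
module BlockDesign where
  open import Defs
  open FinSums
  open Images
  open ListCounting
  open Arithmetic
  open TripleCount using (Contains?; N)
  open import Data.Nat as ℕ using (ℕ; _*_; _∸_; _^_; _/_; _≤_; z≤n; s≤s)
  open import Data.Nat.Properties using (≤-trans; *-assoc)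
  open import Data.Nat.Tactic.RingSolver using (solve-∀)
  open import Data.Fin using (Fin; _≟_)
  open import Data.Fin.Subset using (Subset; ∣_∣)
  open import Data.Bool using () renaming (_≟_ to _≟B_)
  open import Data.Vec.Properties using (≡-dec)
  open import Data.List using (List; filter; length; allFin; map; concatMap)
  open import Data.List.Membership.Propositional using (_∈_)
  open import Data.List.Membership.Propositional.Properties using (∈-map⁻; ∈-filter⁺; ∈-filter⁻; ∈-deduplicate⁻)
  open import Data.List.Relation.Unary.All as All using (All)
  open import Data.List.Relation.Unary.Unique.Propositional using (Unique)
  open import Data.List.Relation.Unary.Unique.DecPropositional.Properties using (deduplicate-!)
  open import Data.Product using (Σ-syntax; _×_; _,_)
  open import Data.Empty using (⊥-elim)
  open import Relation.Nullary using (¬_; Dec; yes; no; ¬?; _×-dec_)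
  open import Relation.Binary.PropositionalEquality

  module Properties (m : ℕ) (2≤m : 2 ≤ m) (F : FiniteField (2 ^ m)) (f : Poly F) (o-poly : IsOPolynomial F f) where
    private
      q k : ℕ
      q = 2 ^ m
      k = q / 2

    2≤q : 2 ≤ q
    2≤q = ≤-trans (s≤s (s≤s z≤n)) (4≤2^m m 2≤m)

    char-2 : FieldFacts.Characteristic2 F
    char-2 = FieldFacts.Properties.characteristic-2 F m refl
    open OPolynomialLines.Properties F char-2 2≤q f o-poly
      using (0#; line; line-00; UniquePreimage; line-0b-bijective; line-a0-bijective)
    open ≡-Reasoning

    Triple : Set
    Triple = Fin q × Fin q × Fin q

    blockOf : Triple → Subset q
    blockOf (a , b , c) = blockHat F f a b c

    Nondegenerate : Triple → Set
    Nondegenerate (a , b , _) = (¬ a ≡ 0#) × (¬ b ≡ 0#)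

    nondegenerate? : ∀ t → Dec (Nondegenerate t)
    nondegenerate? (a , b , _) = ¬? (a ≟ 0#) ×-dec ¬? (b ≟ 0#)

    blocks : List (Subset q)
    blocks = blocksHat F f k

    onto : ∀ {g} → (∀ v → UniquePreimage g v) → ∀ v → Σ[ u ∈ Fin q ] g u ≡ v
    onto bijective v = let (u , hit , _) = bijective v in u , hit

    -- Degenerate lines give blocks of size 1 (a = b = 0) or q (exactly one
    -- of a, b zero), never of size q / 2.
    size-half⇒nondegenerate : ∀ t → ∣ blockOf t ∣ ≡ k → Nondegenerate t
    size-half⇒nondegenerate (a , b , c) size with a ≟ 0# | b ≟ 0#
    ... | no a≢0   | no b≢0   = a≢0 , b≢0
    ... | yes refl | yes refl = ⊥-elim (half≢1 m 2≤m (trans (sym size) (∣image∣-constant F (line 0# 0# c) c (line-00 c))))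
    ... | yes refl | no b≢0   = ⊥-elim (half≢whole m 2≤m (trans (sym size) (∣image∣-surjective F (line 0# b c) (onto (line-0b-bijective b c b≢0)))))
    ... | no a≢0   | yes refl = ⊥-elim (half≢whole m 2≤m (trans (sym size) (∣image∣-surjective F (line a 0# c) (onto (line-a0-bijective a c a≢0)))))

    blocks-unique : Unique blocks
    blocks-unique = deduplicate-! (≡-dec _≟B_) _

    ∈-blocks⁻ : ∀ {B} → B ∈ blocks → Σ[ t ∈ Triple ] t ∈ allTriples F × B ≡ blockOf t × ∣ B ∣ ≡ k
    ∈-blocks⁻ B∈ with ∈-filter⁻ (λ B → ∣ B ∣ ℕ.≟ k) (∈-deduplicate⁻ (≡-dec _≟B_) _ B∈)
    ... | B∈all , size with ∈-map⁻ blockOf B∈all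
    ... | t , t∈ , B≡ = t , t∈ , B≡ , size

    blocks-have-size-half : All (λ B → ∣ B ∣ ≡ k) blocks
    blocks-have-size-half = All.tabulate (λ B∈ → let (_ , _ , _ , size) = ∈-blocks⁻ B∈ in size)

    blocks-covered : ∀ {B} → B ∈ blocks → Σ[ t ∈ Triple ] t ∈ filter nondegenerate? (allTriples F) × B ≡ blockOf t
    blocks-covered B∈ with ∈-blocks⁻ B∈
    ... | t , t∈ , refl , size = t , ∈-filter⁺ nondegenerate? t∈ (size-half⇒nondegenerate t size) , refl

    Lsum-allTriples : ∀ (t : Triple → ℕ) → Lsum (allTriples F) t ≡ Σ (λ a → Σ (λ b → Σ (λ c → t (a , b , c))))
    Lsum-allTriples t = begin
      Lsum (allTriples F) t                                           ≡⟨ Lsum-concatMap (λ a → concatMap (row a) (allFin q)) (allFin q) t ⟩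
      Lsum (allFin q) (λ a → Lsum (concatMap (row a) (allFin q)) t)  ≡⟨ Lsum-allFin {q} (λ a → Lsum (concatMap (row a) (allFin q)) t) ⟩
      Σ (λ a → Lsum (concatMap (row a) (allFin q)) t)
        ≡⟨ Σ-cong {q} (λ a → trans (Lsum-concatMap (row a) (allFin q) t) (trans (Lsum-allFin {q} (λ b → Lsum (row a b) t))
              (Σ-cong {q} (λ b → trans (Lsum-map (λ c → a , b , c) (allFin q) t) (Lsum-allFin {q} (λ c → t (a , b , c))))))) ⟩
      Σ (λ a → Σ (λ b → Σ (λ c → t (a , b , c))))                     ∎
      where
      row : Fin q → Fin q → List Triple
      row a b = map (λ c → a , b , c) (allFin q)

    Lsum-nondegenerate : ∀ (t : Triple → ℕ) →
      Lsum (filter nondegenerate? (allTriples F)) t ≡ Σ-except 0# (λ a → Σ-except 0# (λ b → Σ (λ c → t (a , b , c))))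
    Lsum-nondegenerate t =
      trans (Lsum-filter nondegenerate? (allTriples F) t)
     (trans (Lsum-allTriples (λ t′ → 𝟙 (nondegenerate? t′) * t t′))
            (Σ-cong {q} (λ a → trans (Σ-cong {q} (λ b → factor a b))
                                     (Σ-*ˡ (𝟙 (¬? (a ≟ 0#))) (λ b → 𝟙 (¬? (b ≟ 0#)) * Σ (λ c → t (a , b , c)))))))
      where
      factor : ∀ a b → Σ (λ c → 𝟙 (nondegenerate? (a , b , c)) * t (a , b , c))
                     ≡ 𝟙 (¬? (a ≟ 0#)) * (𝟙 (¬? (b ≟ 0#)) * Σ (λ c → t (a , b , c)))
      factor a b = begin
        Σ (λ c → 𝟙 (nondegenerate? (a , b , c)) * t (a , b , c))  ≡⟨ Σ-*ˡ (𝟙 (¬? (a ≟ 0#) ×-dec ¬? (b ≟ 0#))) (λ c → t (a , b , c)) ⟩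
        𝟙 (¬? (a ≟ 0#) ×-dec ¬? (b ≟ 0#)) * Σ (λ c → t (a , b , c)) ≡⟨ cong (_* Σ (λ c → t (a , b , c))) (𝟙-× (¬? (a ≟ 0#)) (¬? (b ≟ 0#))) ⟩
        𝟙 (¬? (a ≟ 0#)) * 𝟙 (¬? (b ≟ 0#)) * Σ (λ c → t (a , b , c)) ≡⟨ *-assoc (𝟙 (¬? (a ≟ 0#))) _ _ ⟩
        𝟙 (¬? (a ≟ 0#)) * (𝟙 (¬? (b ≟ 0#)) * Σ (λ c → t (a , b , c))) ∎

    #nondegenerate : length (filter nondegenerate? (allTriples F)) ≡ q * ((q ∸ 1) * (q ∸ 1))
    #nondegenerate = begin
      length (filter nondegenerate? (allTriples F))                    ≡⟨ length≡Lsum (filter nondegenerate? (allTriples F)) ⟩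
      Lsum (filter nondegenerate? (allTriples F)) (λ _ → 1)            ≡⟨ Lsum-nondegenerate (λ _ → 1) ⟩
      Σ-except 0# (λ a → Σ-except 0# (λ b → Σ {q} (λ c → 1)))
        ≡⟨ Σ-cong {q} (λ a → cong (𝟙 (¬? (a ≟ 0#)) *_) (trans (Σ-cong {q} (λ b → cong (𝟙 (¬? (b ≟ 0#)) *_) (Σ-const {q} 1)))
                                                             (Σ-except-const 0# (q * 1)))) ⟩
      Σ-except 0# (λ a → (q ∸ 1) * (q * 1))                            ≡⟨ Σ-except-const 0# _ ⟩
      (q ∸ 1) * ((q ∸ 1) * (q * 1))                                    ≡⟨ rearrange (q ∸ 1) q ⟩
      q * ((q ∸ 1) * (q ∸ 1))                                          ∎
      where
      rearrange : ∀ p n → p * (p * (n * 1)) ≡ n * (p * p)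
      rearrange = solve-∀

    #nondegenerate-through : ∀ x y z (x≢y : ¬ x ≡ y) (x≢z : ¬ x ≡ z) (y≢z : ¬ y ≡ z) →
      length (filter (λ t → Contains? x y z (blockOf t)) (filter nondegenerate? (allTriples F)))
        ≡ N F char-2 2≤q f o-poly x y z x≢y x≢z y≢z
    #nondegenerate-through x y z _ _ _ =
      trans (length-filter (λ t → Contains? x y z (blockOf t)) (filter nondegenerate? (allTriples F)))
            (Lsum-nondegenerate (λ t → 𝟙 (Contains? x y z (blockOf t))))

open import Defs
open import Data.Nat using (ℕ; _≤_; _^_; _*_; _∸_; _/_; z≤n; s≤s)
open import Data.Nat.Properties using (≤-trans)
open import Data.Product using (_,_)
open import Data.List using (filter) renaming (length to length')
open import Relation.Binary.PropositionalEquality using (_≡_; sym; trans; module ≡-Reasoning)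
open ListCounting using (covering-preserves-counts)
open Arithmetic using (solve-for-N; 4≤2^m)
open TripleCount using (Contains?; N; triple-count)

mainTheorem3 : (m : ℕ) → 4 ≤ m →
    (F : FiniteField (2 ^ m)) → (f : Poly F) → IsOPolynomial F f →
    length' (blocksHat F f ((2 ^ m) / 2)) ≡ (2 ^ m) * ((2 ^ m ∸ 1) * (2 ^ m ∸ 1)) →
    Is3Design (blocksHat F f ((2 ^ m) / 2)) ((2 ^ m) / 2)
    ((((2 ^ m) ∸ 4) * ((2 ^ m) ∸ 1) * (2 ^ m)) / 8)
mainTheorem3 m 4≤m F f o-poly #blocks =
  blocks-unique , blocks-have-size-half , λ x y z x≢y x≢z y≢z → begin
    countContaining3 blocks x y z
      -- blocks correspond bijectively to the non-degenerate triples
      ≡⟨ covering-preserves-counts blockOf (filter nondegenerate? (allTriples F)) blocks blocks-unique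
           blocks-covered (trans #blocks (sym #nondegenerate)) (Contains? x y z) ⟩
    length' (filter (λ t → Contains? x y z (blockOf t)) (filter nondegenerate? (allTriples F)))
      ≡⟨ #nondegenerate-through x y z x≢y x≢z y≢z ⟩
    N F char-2 2≤q f o-poly x y z x≢y x≢z y≢z
      -- the double counting determines N
      ≡⟨ sym (solve-for-N (2 ^ m) _ (4≤2^m m 2≤m) (triple-count F char-2 2≤q f o-poly x y z x≢y x≢z y≢z)) ⟩
    (2 ^ m ∸ 4) * (2 ^ m ∸ 1) * 2 ^ m / 8 ∎
  where
  open ≡-Reasoning
  2≤m : 2 ≤ m
  2≤m = ≤-trans (s≤s (s≤s z≤n)) 4≤m
  open BlockDesign.Properties m 2≤m F f o-poly
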